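{- Let $n>c_1\ge c_2$ be natural numbers. If $\mathcal D(n,c_1,c_2)$ is not fully graphic, then $\mathcal D(n,c_1,c_2)$ contains a split degree sequence.
   Context: $\mathcal D(n,c_1,c_2)$ is the set of integer sequences $(d_1,\dots,d_n)$ with $c_1\ge d_1\ge\dots\ge d_n\ge c_2$ and $\sum_i d_i$ even; it is fully graphic if all of its elements are graphic (degree sequences of simple graphs). A split graph is a graph whose vertex set can be partitioned into a clique and an independent set. A split degree sequence is a graphic sequence whose realizations are split graphs (if one realization is split, all are). -}

module Defs where

open import Data.Nat using (ℕ; _≤_; _<_; _≥_; _%_)
open import Data.Bool using (Bool; true; false)
open import Data.Fin using (Fin; _<_)
open import Data.Fin.Subset using (Subset; ∣_∣)
open import Data.Vec.Functional using (Vector; foldr)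
open import Data.Vec.Base using (tabulate)
open import Data.Product using (Σ; ∃; _×_)
open import Relation.Binary.PropositionalEquality using (_≡_; _≢_)
open import Relation.Nullary using (¬_)

record SimpleGraph (n : ℕ) : Set where
  field
    adj  : Fin n → Fin n → Bool
    sym  : ∀ i j → adj i j ≡ adj j i
    irr  : ∀ i → adj i i ≡ false
open SimpleGraph public

degree : ∀ {n} → SimpleGraph n → Fin n → ℕ
degree G i = ∣ tabulate (adj G i) ∣

Realizes : ∀ {n} → SimpleGraph n → Vector ℕ n → Set
Realizes G d = ∀ i → degree G i ≡ d i

Graphic : ∀ {n} → Vector ℕ n → Set
Graphic {n} d = Σ (SimpleGraph n) λ G → Realizes G d

IsSplit : ∀ {n} → SimpleGraph n → Set
IsSplit {n} G = Σ (Fin n → Bool) λ K →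
    (∀ i j → i ≢ j → K i ≡ true → K j ≡ true → adj G i j ≡ true)
  × (∀ i j → K i ≡ false → K j ≡ false → adj G i j ≡ false)

SplitDegSeq : ∀ {n} → Vector ℕ n → Set
SplitDegSeq {n} d = Graphic d × (∀ (G : SimpleGraph n) → Realizes G d → IsSplit G)

sumV : ∀ {n} → Vector ℕ n → ℕ
sumV = foldr Data.Nat._+_ 0

InD : (n c₁ c₂ : ℕ) → Vector ℕ n → Set
InD n c₁ c₂ d =
    (∀ i → d i ≤ c₁)
  × (∀ i → c₂ ≤ d i)
  × (∀ (i j : Fin n) → i Data.Fin.< j → d j ≤ d i)
  × (sumV d % 2 ≡ 0)

FullyGraphic : (n c₁ c₂ : ℕ) → Set
FullyGraphic n c₁ c₂ = ∀ (d : Vector ℕ n) → InD n c₁ c₂ d → Graphic d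

-- Write EG_k for the Erdős–Gallai inequality  Σ_{i<k} d_i ≤ k(k-1) + Σ_{i≥k} min(d_i, k).
-- If every k with c₂ < k ≤ c₁ satisfies k c₁ ≤ k(k-1) + (n-k) c₂, then every sequence of
-- 𝒟(n, c₁, c₂) satisfies all EG_k, and is graphic by the Erdős–Gallai theorem, proved here
-- along Choudum's lines: lower the last maximal entry and the last nonzero entry by one,
-- realize the result by induction and put the missing edge back, after a 2-switch if needed.
-- So if 𝒟(n, c₁, c₂) is not fully graphic, some such k violates the bound. Then the degree
-- sequence of a k-clique joined to n - k independent vertices of degree c₂ (the violation is
-- what keeps the clique degrees below c₁) lies in 𝒟(n, c₁, c₂), satisfies every EG_j, and
-- satisfies EG_k with equality; equality in EG_k forces the first k vertices of every
-- realization to form a clique and the others an independent set.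

module Submission where

open import Defs hiding (sym)
open import Data.Bool.Base using (Bool; true; false; if_then_else_; not; _∧_; _∨_; T)
open import Data.Bool.Properties using (∧-comm; ∨-comm)
import Data.Bool.Properties as Boolₚ
open import Data.Empty using (⊥-elim)
open import Data.Fin.Base using (Fin; zero; suc; toℕ; fromℕ<)
open import Data.Fin.Properties using (toℕ<n; toℕ-injective; toℕ-fromℕ<; any?) renaming (_≟_ to _≟ᶠ_)
open import Data.Fin.Subset using (∣_∣)
open import Data.Nat.Base using (ℕ; zero; suc; _+_; _*_; _∸_; _⊓_; _≤_; _<_; z≤n; s≤s; _<ᵇ_; NonZero; >-nonZero)
open import Data.Nat.Properties
open import Data.Nat.Divisibility using (_∣_; _∣0; n∣n; ∣m∣n⇒∣m+n; ∣m+n∣m⇒∣n; m∣m*n; >⇒∤; n∣m⇒m%n≡0; m%n≡0⇒n∣m)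
open import Data.Nat.DivMod using (_/_; _%_; m≡m%n+[m/n]*n; m%n<n)
open import Data.Nat.Solver using (module +-*-Solver)
open import Algebra.Properties.Semiring.Sum +-*-semiring
  using (sum; sum-cong-≗; ∑-distrib-+; ∑-comm; sum-replicate-zero; *-distribˡ-sum)
open import Data.Product using (Σ; ∃; _×_; _,_; proj₁; proj₂)
open import Data.Sum using (_⊎_; inj₁; inj₂)
open import Data.Vec.Base using (tabulate)
open import Data.Vec.Functional using (Vector; replicate)
open import Function.Base using (_∘_)
open import Data.Unit.Base using (tt)
open import Relation.Nullary using (¬_; Dec; yes; no; does; ¬?; _×-dec_)
open import Relation.Nullary.Reflects using (Reflects; ofʸ; ofⁿ)
open import Relation.Binary.PropositionalEquality
open import Relation.Binary.Definitions using (Tri; tri<; tri≈; tri>)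

true≢false : true ≢ false
true≢false ()

𝟙 : Bool → ℕ
𝟙 b = if b then 1 else 0

𝟙≤1 : ∀ b → 𝟙 b ≤ 1
𝟙≤1 true  = ≤-refl
𝟙≤1 false = z≤n

δ : ∀ {n} → Fin n → Fin n → ℕ
δ a i = 𝟙 (does (i ≟ᶠ a))

δ-refl : ∀ {n} (a : Fin n) → δ a a ≡ 1
δ-refl a with a ≟ᶠ a
... | yes _   = refl
... | no a≢a = ⊥-elim (a≢a refl)

δ-≢ : ∀ {n} {a i : Fin n} → i ≢ a → δ a i ≡ 0
δ-≢ {a = a} {i} i≢a with i ≟ᶠ a
... | yes i≡a = ⊥-elim (i≢a i≡a)
... | no _    = refl

<ᵇ-true : ∀ {m n} → m < n → (m <ᵇ n) ≡ true
<ᵇ-true {zero}  (s≤s _) = refl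
<ᵇ-true {suc m} (s≤s (s≤s m<n)) = <ᵇ-true (s≤s m<n)

<ᵇ-false : ∀ {m n} → n ≤ m → (m <ᵇ n) ≡ false
<ᵇ-false {n = zero}  _         = refl
<ᵇ-false {n = suc n} (s≤s n≤m) = <ᵇ-false n≤m

∑-const : ∀ n c → sum {n} (λ _ → c) ≡ n * c
∑-const zero    c = refl
∑-const (suc n) c = cong (c +_) (∑-const n c)

∑-mono-≤ : ∀ {n} {f g : Vector ℕ n} → (∀ i → f i ≤ g i) → sum f ≤ sum g
∑-mono-≤ {zero}  _   = z≤n
∑-mono-≤ {suc n} f≤g = +-mono-≤ (f≤g zero) (∑-mono-≤ (f≤g ∘ suc))

∑≡0⇒≡0 : ∀ {n} (f : Vector ℕ n) → sum f ≡ 0 → ∀ i → f i ≡ 0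
∑≡0⇒≡0 f ∑f≡0 zero    = m+n≡0⇒m≡0 (f zero) ∑f≡0
∑≡0⇒≡0 f ∑f≡0 (suc i) = ∑≡0⇒≡0 (f ∘ suc) (m+n≡0⇒n≡0 (f zero) ∑f≡0) i

∑-mono-≤-rigid : ∀ {n} {f g : Vector ℕ n} → (∀ i → f i ≤ g i) → sum g ≤ sum f → ∀ i → f i ≡ g i
∑-mono-≤-rigid {f = f} {g} f≤g ∑g≤∑f zero = ≤-antisym (f≤g zero)
  (+-cancelʳ-≤ _ _ _ (≤-trans ∑g≤∑f (+-monoʳ-≤ (f zero) (∑-mono-≤ (f≤g ∘ suc)))))
∑-mono-≤-rigid {f = f} {g} f≤g ∑g≤∑f (suc i) = ∑-mono-≤-rigid (f≤g ∘ suc)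
  (+-cancelˡ-≤ (g zero) _ _ (≤-trans ∑g≤∑f (+-monoˡ-≤ _ (f≤g zero)))) i

∑-δ* : ∀ {n} (a : Fin n) (f : Vector ℕ n) → sum (λ i → δ a i * f i) ≡ f a
∑-δ* {suc n} zero    f =
  trans (cong₂ _+_ (+-identityʳ (f zero)) (sum-replicate-zero n)) (+-identityʳ (f zero))
∑-δ* {suc n} (suc a) f = ∑-δ* a (f ∘ suc)

∑-update : ∀ {n} (f : Vector ℕ n) (b : Fin n) v →
  sum (λ j → if does (j ≟ᶠ b) then v else f j) + f b ≡ sum f + v
∑-update f zero v = begin
  v + sum (f ∘ suc) + f zero   ≡⟨ +-assoc v _ _ ⟩
  v + (sum (f ∘ suc) + f zero) ≡⟨ +-comm v _ ⟩
  sum (f ∘ suc) + f zero + v   ≡⟨ cong (_+ v) (+-comm _ (f zero)) ⟩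
  f zero + sum (f ∘ suc) + v   ∎
  where open ≡-Reasoning
∑-update f (suc b) v = begin
  f zero + sum (λ j → if does (j ≟ᶠ b) then v else f (suc j)) + f (suc b)
    ≡⟨ +-assoc (f zero) _ _ ⟩
  f zero + (sum (λ j → if does (j ≟ᶠ b) then v else f (suc j)) + f (suc b))
    ≡⟨ cong (f zero +_) (∑-update (f ∘ suc) b v) ⟩
  f zero + (sum (f ∘ suc) + v)
    ≡⟨ +-assoc (f zero) _ v ⟨
  f zero + sum (f ∘ suc) + v   ∎
  where open ≡-Reasoning

restrict< restrict≥ : ∀ {n} → ℕ → Vector ℕ n → Vector ℕ n
restrict< k f i = if toℕ i <ᵇ k then f i else 0
restrict≥ k f i = if toℕ i <ᵇ k then 0 else f i

sum< sum≥ : ∀ {n} → ℕ → Vector ℕ n → ℕ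
sum< k f = sum (restrict< k f)
sum≥ k f = sum (restrict≥ k f)

module _ {n} (k : ℕ) {f g : Vector ℕ n} (R : ℕ → ℕ → Set) (R-zero : R 0 0) where

  restrict<-pointwise : (∀ i → toℕ i < k → R (f i) (g i)) → ∀ i → R (restrict< k f i) (restrict< k g i)
  restrict<-pointwise fRg i with toℕ i <ᵇ k | <ᵇ-reflects-< (toℕ i) k
  ... | true  | ofʸ i<k = fRg i i<k
  ... | false | _       = R-zero

  restrict≥-pointwise : (∀ i → k ≤ toℕ i → R (f i) (g i)) → ∀ i → R (restrict≥ k f i) (restrict≥ k g i)
  restrict≥-pointwise fRg i with toℕ i <ᵇ k | <ᵇ-reflects-< (toℕ i) k
  ... | true  | _       = R-zero
  ... | false | ofⁿ i≮k = fRg i (≮⇒≥ i≮k)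

restrict<-< : ∀ {n k} (f : Vector ℕ n) {i} → toℕ i < k → restrict< k f i ≡ f i
restrict<-< f {i} i<k = cong (λ b → if b then f i else 0) (<ᵇ-true i<k)

restrict≥-≥ : ∀ {n k} (f : Vector ℕ n) {i} → k ≤ toℕ i → restrict≥ k f i ≡ f i
restrict≥-≥ f {i} k≤i = cong (λ b → if b then 0 else f i) (<ᵇ-false k≤i)

sum<-mono-≤ : ∀ {n} k {f g : Vector ℕ n} → (∀ i → toℕ i < k → f i ≤ g i) → sum< k f ≤ sum< k g
sum<-mono-≤ k f≤g = ∑-mono-≤ (restrict<-pointwise k _≤_ z≤n f≤g)

sum≥-mono-≤ : ∀ {n} k {f g : Vector ℕ n} → (∀ i → k ≤ toℕ i → f i ≤ g i) → sum≥ k f ≤ sum≥ k g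
sum≥-mono-≤ k f≤g = ∑-mono-≤ (restrict≥-pointwise k _≤_ z≤n f≤g)

sum<-cong : ∀ {n} k {f g : Vector ℕ n} → (∀ i → toℕ i < k → f i ≡ g i) → sum< k f ≡ sum< k g
sum<-cong k f≡g = sum-cong-≗ (restrict<-pointwise k _≡_ refl f≡g)

sum≥-cong : ∀ {n} k {f g : Vector ℕ n} → (∀ i → k ≤ toℕ i → f i ≡ g i) → sum≥ k f ≡ sum≥ k g
sum≥-cong k f≡g = sum-cong-≗ (restrict≥-pointwise k _≡_ refl f≡g)

sum<-rigid : ∀ {n} k {f g : Vector ℕ n} → (∀ i → toℕ i < k → f i ≤ g i) → sum< k g ≤ sum< k f →
             ∀ i → toℕ i < k → f i ≡ g i
sum<-rigid k {f} {g} f≤g ∑g≤∑f i i<k = begin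
  f i              ≡⟨ restrict<-< f i<k ⟨
  restrict< k f i  ≡⟨ ∑-mono-≤-rigid (restrict<-pointwise k _≤_ z≤n f≤g) ∑g≤∑f i ⟩
  restrict< k g i  ≡⟨ restrict<-< g i<k ⟩
  g i              ∎
  where open ≡-Reasoning

sum≥≡0⇒≡0 : ∀ {n} k (f : Vector ℕ n) → sum≥ k f ≡ 0 → ∀ i → k ≤ toℕ i → f i ≡ 0
sum≥≡0⇒≡0 k f ∑f≡0 i k≤i = trans (sym (restrict≥-≥ f k≤i)) (∑≡0⇒≡0 (restrict≥ k f) ∑f≡0 i)

sum<+sum≥ : ∀ {n} k (f : Vector ℕ n) → sum< k f + sum≥ k f ≡ sum f
sum<+sum≥ k f = trans (sym (∑-distrib-+ (restrict< k f) (restrict≥ k f))) (sum-cong-≗ split)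
  where
  split : ∀ i → restrict< k f i + restrict≥ k f i ≡ f i
  split i with toℕ i <ᵇ k
  ... | true  = +-identityʳ (f i)
  ... | false = refl

sum<≤sum : ∀ {n} k (f : Vector ℕ n) → sum< k f ≤ sum f
sum<≤sum k f = ≤-trans (m≤m+n _ _) (≤-reflexive (sum<+sum≥ k f))

sum<-const : ∀ {n} k c → k ≤ n → sum< {n} k (λ _ → c) ≡ k * c
sum<-const {n}     zero    c _         = sum-replicate-zero n
sum<-const {suc n} (suc k) c (s≤s k≤n) = cong (c +_) (sum<-const k c k≤n)

sum≥-const : ∀ {n} k c → k ≤ n → sum≥ {n} k (λ _ → c) ≡ (n ∸ k) * c
sum≥-const {n}     zero    c _         = ∑-const n c
sum≥-const {suc n} (suc k) c (s≤s k≤n) = sum≥-const k c k≤n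

sum<-+ : ∀ {n} k (f g : Vector ℕ n) → sum< k (λ i → f i + g i) ≡ sum< k f + sum< k g
sum<-+ k f g = trans (sum-cong-≗ pointwise) (∑-distrib-+ (restrict< k f) (restrict< k g))
  where
  pointwise : ∀ i → restrict< k (λ i → f i + g i) i ≡ restrict< k f i + restrict< k g i
  pointwise i with toℕ i <ᵇ k
  ... | true  = refl
  ... | false = refl

sum≥-+ : ∀ {n} k (f g : Vector ℕ n) → sum≥ k (λ i → f i + g i) ≡ sum≥ k f + sum≥ k g
sum≥-+ k f g = trans (sum-cong-≗ pointwise) (∑-distrib-+ (restrict≥ k f) (restrict≥ k g))
  where
  pointwise : ∀ i → restrict≥ k (λ i → f i + g i) i ≡ restrict≥ k f i + restrict≥ k g i
  pointwise i with toℕ i <ᵇ k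
  ... | true  = refl
  ... | false = refl

sum≥-*ˡ : ∀ {n} k c (f : Vector ℕ n) → sum≥ k (λ i → c * f i) ≡ c * sum≥ k f
sum≥-*ˡ k c f = trans (sum-cong-≗ pointwise) (sym (*-distribˡ-sum c (restrict≥ k f)))
  where
  pointwise : ∀ i → restrict≥ k (λ i → c * f i) i ≡ c * restrict≥ k f i
  pointwise i with toℕ i <ᵇ k
  ... | true  = sym (*-zeroʳ c)
  ... | false = refl

∑-δ : ∀ {n} (a : Fin n) → sum (δ a) ≡ 1
∑-δ a = trans (sum-cong-≗ (λ i → sym (*-identityʳ (δ a i)))) (∑-δ* a (λ _ → 1))

sum<-δ : ∀ {n} k (a : Fin n) → sum< k (δ a) ≡ 𝟙 (toℕ a <ᵇ k)
sum<-δ k a = trans (sum-cong-≗ pointwise) (∑-δ* a (λ i → 𝟙 (toℕ i <ᵇ k)))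
  where
  pointwise : ∀ i → restrict< k (δ a) i ≡ δ a i * 𝟙 (toℕ i <ᵇ k)
  pointwise i with toℕ i <ᵇ k
  ... | true  = sym (*-identityʳ (δ a i))
  ... | false = sym (*-zeroʳ (δ a i))

sum≥-δ : ∀ {n} k (a : Fin n) → sum≥ k (δ a) ≡ 𝟙 (not (toℕ a <ᵇ k))
sum≥-δ k a = trans (sum-cong-≗ pointwise) (∑-δ* a (λ i → 𝟙 (not (toℕ i <ᵇ k))))
  where
  pointwise : ∀ i → restrict≥ k (δ a) i ≡ δ a i * 𝟙 (not (toℕ i <ᵇ k))
  pointwise i with toℕ i <ᵇ k
  ... | true  = sym (*-zeroʳ (δ a i))
  ... | false = sym (*-identityʳ (δ a i))

sum≥-peel : ∀ {n k} (k<n : k < n) (f : Vector ℕ n) → sum≥ k f ≡ f (fromℕ< k<n) + sum≥ (suc k) f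
sum≥-peel {suc n} {zero}  _         f = refl
sum≥-peel {suc n} {suc k} (s≤s k<n) f = sum≥-peel k<n (f ∘ suc)

sum<-count : ∀ {n} k r → k ≤ n → sum< {n} k (λ i → 𝟙 (toℕ i <ᵇ r)) ≡ k ⊓ r
sum<-count {n}     zero    r       _         = sum-replicate-zero n
sum<-count {suc n} (suc k) zero    (s≤s k≤n) = trans (sum<-const k 0 k≤n) (*-zeroʳ k)
sum<-count {suc n} (suc k) (suc r) (s≤s k≤n) = cong suc (sum<-count k r k≤n)

sum<-extend : ∀ {n k k′} → k ≤ k′ → (f : Vector ℕ n) → sum< k′ f ≡ sum< k f + sum≥ k (restrict< k′ f)
sum<-extend {k = k} {k′} k≤k′ f = begin
  sum< k′ f                                           ≡⟨ sum<+sum≥ k (restrict< k′ f) ⟨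
  sum< k (restrict< k′ f) + sum≥ k (restrict< k′ f)   ≡⟨ cong (_+ sum≥ k (restrict< k′ f)) (sum<-cong k (λ i i<k → restrict<-< f (<-≤-trans i<k k≤k′))) ⟩
  sum< k f + sum≥ k (restrict< k′ f)                  ∎
  where open ≡-Reasoning

sum≥-band : ∀ {n k k′} c → k ≤ k′ → k′ ≤ n → sum≥ {n} k (restrict< k′ (λ _ → c)) ≡ (k′ ∸ k) * c
sum≥-band {n} {k} {k′} c k≤k′ k′≤n = +-cancelˡ-≡ (k * c) _ _ (begin
  k * c + sum≥ k band                ≡⟨ cong (_+ sum≥ k band) (sum<-const k c (≤-trans k≤k′ k′≤n)) ⟨
  sum< k constant + sum≥ k band      ≡⟨ sum<-extend k≤k′ constant ⟨
  sum< k′ constant                   ≡⟨ sum<-const k′ c k′≤n ⟩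
  k′ * c                             ≡⟨ cong (_* c) (m+[n∸m]≡n k≤k′) ⟨
  (k + (k′ ∸ k)) * c                 ≡⟨ *-distribʳ-+ c k (k′ ∸ k) ⟩
  k * c + (k′ ∸ k) * c               ∎)
  where
  open ≡-Reasoning
  constant band : Vector ℕ n
  constant _ = c
  band = restrict< k′ constant

sum≥-restrict≥ : ∀ {n k k′} → k ≤ k′ → (f : Vector ℕ n) → sum≥ k (restrict≥ k′ f) ≡ sum≥ k′ f
sum≥-restrict≥ {k = k} {k′} k≤k′ f = sum-cong-≗ pointwise
  where
  pointwise : ∀ i → restrict≥ k (restrict≥ k′ f) i ≡ restrict≥ k′ f i
  pointwise i with toℕ i <ᵇ k | <ᵇ-reflects-< (toℕ i) k
  ... | true  | ofʸ i<k = sym (cong (λ b → if b then 0 else f i) (<ᵇ-true (<-≤-trans i<k k≤k′)))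
  ... | false | _       = refl

degree-∑ : ∀ {n} (G : SimpleGraph n) i → degree G i ≡ sum (λ j → 𝟙 (adj G i j))
degree-∑ G i = count (adj G i)
  where
  count : ∀ {m} (f : Fin m → Bool) → ∣ tabulate f ∣ ≡ sum (λ j → 𝟙 (f j))
  count {zero}  f = refl
  count {suc m} f with f zero
  ... | true  = cong suc (count (f ∘ suc))
  ... | false = count (f ∘ suc)

isPair : ∀ {n} → Fin n → Fin n → Fin n → Fin n → Bool
isPair a b i j = (does (i ≟ᶠ a) ∧ does (j ≟ᶠ b)) ∨ (does (i ≟ᶠ b) ∧ does (j ≟ᶠ a))

isPair-sym : ∀ {n} (a b i j : Fin n) → isPair a b i j ≡ isPair a b j i
isPair-sym a b i j = trans (∨-comm (does (i ≟ᶠ a) ∧ does (j ≟ᶠ b)) _)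
  (cong₂ _∨_ (∧-comm (does (i ≟ᶠ b)) _) (∧-comm (does (i ≟ᶠ a)) _))

isPair-swap : ∀ {n} (a b i j : Fin n) → isPair a b i j ≡ isPair b a i j
isPair-swap a b i j = ∨-comm (does (i ≟ᶠ a) ∧ does (j ≟ᶠ b)) _

isPair-left : ∀ {n} {a b : Fin n} → a ≢ b → ∀ j → isPair a b a j ≡ does (j ≟ᶠ b)
isPair-left {a = a} {b} a≢b j with a ≟ᶠ a | a ≟ᶠ b | j ≟ᶠ b
... | no a≢a | _         | _     = ⊥-elim (a≢a refl)
... | _      | yes a≡b   | _     = ⊥-elim (a≢b a≡b)
... | yes _  | no _      | yes _ = refl
... | yes _  | no _      | no _  = refl

isPair-outside : ∀ {n} {a b i : Fin n} → i ≢ a → i ≢ b → ∀ j → isPair a b i j ≡ false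
isPair-outside {a = a} {b} {i} i≢a i≢b j with i ≟ᶠ a | i ≟ᶠ b
... | yes i≡a | _       = ⊥-elim (i≢a i≡a)
... | no _    | yes i≡b = ⊥-elim (i≢b i≡b)
... | no _    | no _    = refl

isPair-irrefl : ∀ {n} {a b : Fin n} → a ≢ b → ∀ i → isPair a b i i ≡ false
isPair-irrefl {a = a} {b} a≢b i with i ≟ᶠ a | i ≟ᶠ b
... | yes refl | yes refl = ⊥-elim (a≢b refl)
... | yes _    | no _     = refl
... | no _     | yes _    = refl
... | no _     | no _     = refl

setEdge : ∀ {n} (G : SimpleGraph n) {a b : Fin n} → a ≢ b → Bool → SimpleGraph n
setEdge G {a} {b} a≢b v = record
  { adj = λ i j → if isPair a b i j then v else adj G i j
  ; sym = λ i j → cong₂ (λ c x → if c then v else x) (isPair-sym a b i j) (SimpleGraph.sym G i j)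
  ; irr = λ i → trans (cong (λ c → if c then v else adj G i i) (isPair-irrefl a≢b i)) (irr G i)
  }

module _ {n} (G : SimpleGraph n) {a b : Fin n} (a≢b : a ≢ b) where

  private
    updated-degree : ∀ v i p → (∀ j → isPair a b i j ≡ does (j ≟ᶠ p)) →
      degree (setEdge G a≢b v) i + 𝟙 (adj G i p) ≡ degree G i + 𝟙 v
    updated-degree v i p row = begin
      degree (setEdge G a≢b v) i + 𝟙 (adj G i p)
        ≡⟨ cong (_+ 𝟙 (adj G i p)) (trans (degree-∑ (setEdge G a≢b v) i) (sum-cong-≗ updated-row)) ⟩
      sum (λ j → if does (j ≟ᶠ p) then 𝟙 v else 𝟙 (adj G i j)) + 𝟙 (adj G i p)
        ≡⟨ ∑-update (λ j → 𝟙 (adj G i j)) p (𝟙 v) ⟩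
      sum (λ j → 𝟙 (adj G i j)) + 𝟙 v
        ≡⟨ cong (_+ 𝟙 v) (degree-∑ G i) ⟨
      degree G i + 𝟙 v ∎
      where
      open ≡-Reasoning
      updated-row : ∀ j → 𝟙 (if isPair a b i j then v else adj G i j) ≡ (if does (j ≟ᶠ p) then 𝟙 v else 𝟙 (adj G i j))
      updated-row j rewrite row j with does (j ≟ᶠ p)
      ... | true  = refl
      ... | false = refl

    untouched-degree : ∀ v i → i ≢ a → i ≢ b → degree (setEdge G a≢b v) i ≡ degree G i
    untouched-degree v i i≢a i≢b = begin
      degree (setEdge G a≢b v) i                           ≡⟨ degree-∑ (setEdge G a≢b v) i ⟩
      sum (λ j → 𝟙 (if isPair a b i j then v else adj G i j)) ≡⟨ sum-cong-≗ (λ j → cong (λ c → 𝟙 (if c then v else adj G i j)) (isPair-outside i≢a i≢b j)) ⟩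
      sum (λ j → 𝟙 (adj G i j))                            ≡⟨ degree-∑ G i ⟨
      degree G i                                           ∎
      where open ≡-Reasoning

  degree-setEdge : ∀ v i →
    degree (setEdge G a≢b v) i + 𝟙 (adj G a b) * (δ a i + δ b i) ≡ degree G i + 𝟙 v * (δ a i + δ b i)
  degree-setEdge v i = by-cases (i ≟ᶠ a) (i ≟ᶠ b)
    where
    G′ : SimpleGraph n
    G′ = setEdge G a≢b v
    open ≡-Reasoning
    endpoint : ∀ {x y} → δ a i + δ b i ≡ 1 → degree G′ i + x ≡ degree G i + y →
               degree G′ i + x * (δ a i + δ b i) ≡ degree G i + y * (δ a i + δ b i)
    endpoint {x} {y} ends≡1 eq = begin
      degree G′ i + x * (δ a i + δ b i) ≡⟨ cong (λ e → degree G′ i + x * e) ends≡1 ⟩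
      degree G′ i + x * 1               ≡⟨ cong (degree G′ i +_) (*-identityʳ x) ⟩
      degree G′ i + x                   ≡⟨ eq ⟩
      degree G i + y                    ≡⟨ cong (degree G i +_) (*-identityʳ y) ⟨
      degree G i + y * 1                ≡⟨ cong (λ e → degree G i + y * e) ends≡1 ⟨
      degree G i + y * (δ a i + δ b i)  ∎
    by-cases : Dec (i ≡ a) → Dec (i ≡ b) →
      degree G′ i + 𝟙 (adj G a b) * (δ a i + δ b i) ≡ degree G i + 𝟙 v * (δ a i + δ b i)
    by-cases (yes refl) (yes refl) = ⊥-elim (a≢b refl)
    by-cases (yes refl) (no _) =
      endpoint (cong₂ _+_ (δ-refl a) (δ-≢ a≢b)) (updated-degree v a b (isPair-left a≢b))
    by-cases (no _) (yes refl) =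
      endpoint (cong₂ _+_ (δ-≢ (a≢b ∘ sym)) (δ-refl b))
        (subst (λ e → degree G′ b + 𝟙 e ≡ degree G b + 𝟙 v) (SimpleGraph.sym G b a)
          (updated-degree v b a (λ j → trans (isPair-swap a b b j) (isPair-left (a≢b ∘ sym) j))))
    by-cases (no i≢a) (no i≢b) = begin
      degree G′ i + 𝟙 (adj G a b) * (δ a i + δ b i) ≡⟨ cong (λ e → degree G′ i + 𝟙 (adj G a b) * e) ends≡0 ⟩
      degree G′ i + 𝟙 (adj G a b) * 0               ≡⟨ cong₂ _+_ (untouched-degree v i i≢a i≢b) (*-zeroʳ (𝟙 (adj G a b))) ⟩
      degree G i + 0                                ≡⟨ cong (degree G i +_) (*-zeroʳ (𝟙 v)) ⟨
      degree G i + 𝟙 v * 0                          ≡⟨ cong (λ e → degree G i + 𝟙 v * e) ends≡0 ⟨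
      degree G i + 𝟙 v * (δ a i + δ b i)            ∎
      where
      ends≡0 : δ a i + δ b i ≡ 0
      ends≡0 = cong₂ _+_ (δ-≢ i≢a) (δ-≢ i≢b)

  degree-addEdge : adj G a b ≡ false → ∀ i → degree (setEdge G a≢b true) i ≡ degree G i + (δ a i + δ b i)
  degree-addEdge ab≡false i = begin
    degree (setEdge G a≢b true) i                                   ≡⟨ +-identityʳ _ ⟨
    degree (setEdge G a≢b true) i + 𝟙 false * (δ a i + δ b i)       ≡⟨ cong (λ x → degree (setEdge G a≢b true) i + 𝟙 x * (δ a i + δ b i)) ab≡false ⟨
    degree (setEdge G a≢b true) i + 𝟙 (adj G a b) * (δ a i + δ b i) ≡⟨ degree-setEdge true i ⟩
    degree G i + 1 * (δ a i + δ b i)                                ≡⟨ cong (degree G i +_) (*-identityˡ _) ⟩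
    degree G i + (δ a i + δ b i)                                    ∎
    where open ≡-Reasoning

  degree-removeEdge : adj G a b ≡ true → ∀ i → degree (setEdge G a≢b false) i + (δ a i + δ b i) ≡ degree G i
  degree-removeEdge ab≡true i = begin
    degree (setEdge G a≢b false) i + (δ a i + δ b i)                 ≡⟨ cong (degree (setEdge G a≢b false) i +_) (*-identityˡ _) ⟨
    degree (setEdge G a≢b false) i + 1 * (δ a i + δ b i)             ≡⟨ cong (λ x → degree (setEdge G a≢b false) i + 𝟙 x * (δ a i + δ b i)) ab≡true ⟨
    degree (setEdge G a≢b false) i + 𝟙 (adj G a b) * (δ a i + δ b i) ≡⟨ degree-setEdge false i ⟩
    degree G i + 0                                                   ≡⟨ +-identityʳ _ ⟩
    degree G i                                                       ∎
    where open ≡-Reasoning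

  adj-setEdge-outside : ∀ v {i} → i ≢ a → i ≢ b → ∀ j → adj (setEdge G a≢b v) i j ≡ adj G i j
  adj-setEdge-outside v i≢a i≢b j = cong (λ c → if c then v else _) (isPair-outside i≢a i≢b j)

-- The Erdős–Gallai theorem

NonIncreasing : ∀ {n} → Vector ℕ n → Set
NonIncreasing d = ∀ i j → toℕ i < toℕ j → d j ≤ d i

NonIncreasing-≤ : ∀ {n} {d : Vector ℕ n} → NonIncreasing d → ∀ {i j} → toℕ i ≤ toℕ j → d j ≤ d i
NonIncreasing-≤ {d = d} d-noninc {i} {j} i≤j with m≤n⇒m<n∨m≡n i≤j
... | inj₁ i<j = d-noninc i j i<j
... | inj₂ i≡j = ≤-reflexive (cong d (sym (toℕ-injective i≡j)))

tail⊓ : ∀ {n} → ℕ → Vector ℕ n → ℕ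
tail⊓ k d = sum≥ k (λ i → d i ⊓ k)

ErdősGallai : ∀ {n} → Vector ℕ n → Set
ErdősGallai d = ∀ k → sum< k d ≤ k * (k ∸ 1) + tail⊓ k d

m*m≡m*[m∸1]+m : ∀ m → m * m ≡ m * (m ∸ 1) + m
m*m≡m*[m∸1]+m zero    = refl
m*m≡m*[m∸1]+m (suc m) = trans (*-suc (suc m) m) (+-comm (suc m) _)

⊓-+-≤ : ∀ x e k → (x + e) ⊓ k ≤ x ⊓ k + e
⊓-+-≤ x e k = begin
  (x + e) ⊓ k       ≤⟨ ⊓-monoʳ-≤ (x + e) (m≤m+n k e) ⟩
  (x + e) ⊓ (k + e) ≡⟨ +-distribʳ-⊓ e x k ⟨
  x ⊓ k + e         ∎
  where open ≤-Reasoning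

⊓-suc : ∀ x k → x ⊓ suc k ≡ x ⊓ k + 𝟙 (k <ᵇ x)
⊓-suc zero    k       = refl
⊓-suc (suc x) zero    = cong suc (⊓-zeroʳ x)
⊓-suc (suc x) (suc k) = cong suc (⊓-suc x k)

k*𝟙[k<x]≤x⊓k : ∀ k x → k * 𝟙 (k <ᵇ x) ≤ x ⊓ k
k*𝟙[k<x]≤x⊓k k x with k <ᵇ x | <ᵇ-reflects-< k x
... | true  | ofʸ k<x = ≤-reflexive (trans (*-identityʳ k) (sym (m≥n⇒m⊓n≡n (<⇒≤ k<x))))
... | false | _       = ≤-trans (≤-reflexive (*-zeroʳ k)) z≤n

2∣n*[1+n] : ∀ n → 2 ∣ n * suc n
2∣n*[1+n] zero    = 2 ∣0
2∣n*[1+n] (suc n) = subst (2 ∣_) (sym step) (∣m∣n⇒∣m+n (2∣n*[1+n] n) (m∣m*n (suc n)))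
  where
  open +-*-Solver
  step : suc n * suc (suc n) ≡ n * suc n + 2 * suc n
  step = solve 1 (λ n → (con 1 :+ n) :* (con 2 :+ n) := n :* (con 1 :+ n) :+ con 2 :* (con 1 :+ n)) refl n

¬2∣m*m+[1+m] : ∀ m → ¬ 2 ∣ m * m + suc m
¬2∣m*m+[1+m] m 2∣odd = >⇒∤ (s≤s (s≤s z≤n)) (∣m+n∣m⇒∣n (subst (2 ∣_) odd 2∣odd) (2∣n*[1+n] m))
  where
  open +-*-Solver
  odd : m * m + suc m ≡ m * suc m + 1
  odd = solve 1 (λ m → m :* m :+ (con 1 :+ m) := m :* (con 1 :+ m) :+ con 1) refl m

-- Q stands for tail⊓ k d and A for the number of tail entries exceeding k; the first
-- hypothesis is the Erdős–Gallai inequality at k + 1.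
choudum-arith : ∀ k M Q A → suc k * M + suc k ≤ suc k * k + (Q + A) → k * A + 1 ≤ Q →
                k * M + 1 ≤ k * (k ∸ 1) + Q
choudum-arith k M Q A big small = +-cancelʳ-≤ k _ _ (begin
  k * M + 1 + k       ≡⟨ solve 2 (λ k M → k :* M :+ con 1 :+ k := k :* (con 1 :+ M) :+ con 1) refl k M ⟩
  k * suc M + 1       ≤⟨ bound (suc M ≤? k + A) ⟩
  k * k + Q           ≡⟨ cong (_+ Q) (m*m≡m*[m∸1]+m k) ⟩
  k * (k ∸ 1) + k + Q ≡⟨ solve 3 (λ x k Q → x :+ k :+ Q := x :+ Q :+ k) refl (k * (k ∸ 1)) k Q ⟩
  k * (k ∸ 1) + Q + k ∎)
  where
  open ≤-Reasoning
  open +-*-Solver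
  bound : Dec (suc M ≤ k + A) → k * suc M + 1 ≤ k * k + Q
  bound (yes M<k+A) = begin
    k * suc M + 1     ≤⟨ +-monoˡ-≤ 1 (*-monoʳ-≤ k M<k+A) ⟩
    k * (k + A) + 1   ≡⟨ solve 3 (λ k A one → k :* (k :+ A) :+ one := k :* k :+ (k :* A :+ one)) refl k A 1 ⟩
    k * k + (k * A + 1) ≤⟨ +-monoʳ-≤ (k * k) small ⟩
    k * k + Q         ∎
  bound (no M≮k+A) = +-cancelʳ-≤ (k + A) _ _ (begin
    k * suc M + 1 + (k + A) ≡⟨ solve 3 (λ k M A → k :* (con 1 :+ M) :+ con 1 :+ (k :+ A) := k :* (con 1 :+ M) :+ (con 1 :+ (k :+ A))) refl k M A ⟩
    k * suc M + suc (k + A) ≤⟨ +-monoʳ-≤ (k * suc M) (s≤s (≮⇒≥ M≮k+A)) ⟩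
    k * suc M + suc M       ≡⟨ solve 2 (λ k M → k :* (con 1 :+ M) :+ (con 1 :+ M) := (con 1 :+ k) :* M :+ (con 1 :+ k)) refl k M ⟩
    suc k * M + suc k       ≤⟨ big ⟩
    suc k * k + (Q + A)     ≡⟨ solve 3 (λ k Q A → (con 1 :+ k) :* k :+ (Q :+ A) := k :* k :+ Q :+ (k :+ A)) refl k Q A ⟩
    k * k + Q + (k + A)     ∎)

last-index : ∀ {n p} {P : Fin n → Set p} → (∀ i → Dec (P i)) → ∀ {i} → P i →
             ∃ λ j → P j × (∀ k → toℕ j < toℕ k → ¬ P k)
last-index {suc n} P? {i} Pi with any? (P? ∘ suc)
... | yes (i′ , Pi′) with last-index (P? ∘ suc) Pi′
...   | j , Pj , none-after = suc j , Pj , λ { zero () ; (suc k) (s≤s j<k) → none-after k j<k }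
last-index {suc n} P? {zero}  Pi | no none = zero , Pi , λ { zero () ; (suc k) _ Pk → none (k , Pk) }
last-index {suc n} P? {suc i} Pi | no none = ⊥-elim (none (i , Pi))

positive-entry : ∀ {n} (d : Vector ℕ n) → 0 < sum d → ∃ λ i → 0 < d i
positive-entry {n} d ∑d>0 with any? (λ i → 0 <? d i)
... | yes witness = witness
... | no none = ⊥-elim (<-irrefl (sym ∑d≡0) ∑d>0)
  where
  ∑d≡0 : sum d ≡ 0
  ∑d≡0 = trans (sum-cong-≗ (λ i → n≤0⇒n≡0 (≮⇒≥ (λ d>0 → none (i , d>0))))) (sum-replicate-zero n)

-- The Erdős–Gallai inequality at k = 1 bounds d₀ by the number of other nonzero entries.
head≤last-nonzero : ∀ {n} {d : Vector ℕ (suc n)} → ErdősGallai d →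
                    ∀ q → (∀ j → toℕ q < toℕ j → d j ≡ 0) → d zero ≤ toℕ q
head≤last-nonzero {n} {d} d-eg q zero-after-q = begin
  d zero                           ≤⟨ m≤m+n (d zero) _ ⟩
  sum< 1 d                         ≤⟨ d-eg 1 ⟩
  sum (λ i → d (suc i) ⊓ 1)        ≤⟨ ∑-mono-≤ capped ⟩
  sum< {n} (toℕ q) (λ _ → 1)       ≡⟨ sum<-const {n} (toℕ q) 1 (≤-pred (toℕ<n q)) ⟩
  toℕ q * 1                        ≡⟨ *-identityʳ (toℕ q) ⟩
  toℕ q                            ∎
  where
  open ≤-Reasoning
  capped : ∀ i → d (suc i) ⊓ 1 ≤ (if toℕ i <ᵇ toℕ q then 1 else 0)
  capped i with toℕ i <ᵇ toℕ q | <ᵇ-reflects-< (toℕ i) (toℕ q)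
  ... | true  | _       = m⊓n≤n (d (suc i)) 1
  ... | false | ofⁿ i≮q = ≤-reflexive (cong (_⊓ 1) (zero-after-q (suc i) (s≤s (≮⇒≥ i≮q))))

-- The two entries lowered by one in Choudum's reduction.
record Pivots {n} (d : Vector ℕ (suc n)) : Set where
  field
    t q          : Fin (suc n)
    t<q          : toℕ t < toℕ q
    dt≡M         : d t ≡ d zero
    dq>0         : 0 < d q
    M≤q          : d zero ≤ toℕ q
    zero-after-q : ∀ j → toℕ q < toℕ j → d j ≡ 0
    below-M      : ∀ j → toℕ t < toℕ j → toℕ j < toℕ q → d j < d zero

pivots : ∀ {n} (d : Vector ℕ (suc n)) → 0 < sum d → NonIncreasing d → ErdősGallai d → Pivots d
pivots {n} d ∑d>0 d-noninc d-eg = record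
  { t = t ; q = q ; t<q = proj₂ (proj₁ (proj₂ last-maximal)) ; dt≡M = proj₁ (proj₁ (proj₂ last-maximal))
  ; dq>0 = dq>0 ; M≤q = M≤q ; zero-after-q = zero-after-q
  ; below-M = λ j t<j j<q → ≤∧≢⇒< (NonIncreasing-≤ d-noninc z≤n) (λ dj≡M → proj₂ (proj₂ last-maximal) j t<j (dj≡M , j<q))
  }
  where
  last-positive : ∃ λ q → 0 < d q × (∀ j → toℕ q < toℕ j → ¬ 0 < d j)
  last-positive = last-index (λ i → 0 <? d i) (proj₂ (positive-entry d ∑d>0))
  q : Fin (suc n)
  q = proj₁ last-positive
  dq>0 : 0 < d q
  dq>0 = proj₁ (proj₂ last-positive)
  zero-after-q : ∀ j → toℕ q < toℕ j → d j ≡ 0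
  zero-after-q j q<j = n≤0⇒n≡0 (≮⇒≥ (proj₂ (proj₂ last-positive) j q<j))
  M≤q : d zero ≤ toℕ q
  M≤q = head≤last-nonzero {d = d} d-eg q zero-after-q
  last-maximal : ∃ λ t → (d t ≡ d zero × toℕ t < toℕ q) × (∀ j → toℕ t < toℕ j → ¬ (d j ≡ d zero × toℕ j < toℕ q))
  last-maximal = last-index (λ j → d j ≟ d zero ×-dec toℕ j <? toℕ q) {zero}
                   (refl , ≤-trans dq>0 (≤-trans (NonIncreasing-≤ d-noninc z≤n) M≤q))
  t : Fin (suc n)
  t = proj₁ last-maximal

module ChoudumReduction {n} (d : Vector ℕ (suc n)) (d-noninc : NonIncreasing d) (d-eg : ErdősGallai d)
  (d-even : 2 ∣ sum d) (P : Pivots d) where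

  open Pivots P

  M : ℕ
  M = d zero

  ends : Vector ℕ (suc n)
  ends i = δ t i + δ q i

  d′ : Vector ℕ (suc n)
  d′ i = d i ∸ ends i

  t≢q : t ≢ q
  t≢q t≡q = <-irrefl (cong toℕ t≡q) t<q

  d≤M : ∀ i → d i ≤ M
  d≤M i = NonIncreasing-≤ d-noninc z≤n

  d-top : ∀ i → toℕ i ≤ toℕ t → d i ≡ M
  d-top i i≤t = ≤-antisym (d≤M i) (subst (_≤ d i) dt≡M (NonIncreasing-≤ d-noninc i≤t))

  ends-t : ends t ≡ 1
  ends-t = cong₂ _+_ (δ-refl t) (δ-≢ t≢q)

  ends-q : ends q ≡ 1
  ends-q = cong₂ _+_ (δ-≢ (t≢q ∘ sym)) (δ-refl q)

  ends-off-t : ∀ {i} → i ≢ t → ends i ≡ δ q i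
  ends-off-t {i} i≢t = cong (_+ δ q i) (δ-≢ i≢t)

  ends-elsewhere : ∀ {i} → i ≢ t → i ≢ q → ends i ≡ 0
  ends-elsewhere i≢t i≢q = cong₂ _+_ (δ-≢ i≢t) (δ-≢ i≢q)

  ends≤1 : ∀ i → ends i ≤ 1
  ends≤1 i = by-cases (i ≟ᶠ t)
    where
    by-cases : Dec (i ≡ t) → ends i ≤ 1
    by-cases (yes refl) = ≤-reflexive ends-t
    by-cases (no i≢t)   = subst (_≤ 1) (sym (ends-off-t i≢t)) (𝟙≤1 _)

  ends≤d : ∀ i → ends i ≤ d i
  ends≤d i = by-cases (i ≟ᶠ t) (i ≟ᶠ q)
    where
    by-cases : Dec (i ≡ t) → Dec (i ≡ q) → ends i ≤ d i
    by-cases (yes refl) _          = subst (_≤ d t) (sym ends-t) (≤-trans dq>0 (d-noninc t q t<q))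
    by-cases (no _)     (yes refl) = subst (_≤ d q) (sym ends-q) dq>0
    by-cases (no i≢t)   (no i≢q)   = subst (_≤ d i) (sym (ends-elsewhere i≢t i≢q)) z≤n

  d≡d′+ends : ∀ i → d i ≡ d′ i + ends i
  d≡d′+ends i = sym (m∸n+n≡m (ends≤d i))

  d′-elsewhere : ∀ {i} → i ≢ t → i ≢ q → d′ i ≡ d i
  d′-elsewhere {i} i≢t i≢q = cong (d i ∸_) (ends-elsewhere i≢t i≢q)

  sum-d : sum d ≡ sum d′ + 2
  sum-d = begin
    sum d                    ≡⟨ sum-cong-≗ d≡d′+ends ⟩
    sum (λ i → d′ i + ends i) ≡⟨ ∑-distrib-+ d′ ends ⟩
    sum d′ + sum ends        ≡⟨ cong (sum d′ +_) (trans (∑-distrib-+ (δ t) (δ q)) (cong₂ _+_ (∑-δ t) (∑-δ q))) ⟩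
    sum d′ + 2               ∎
    where open ≡-Reasoning

  d′-noninc : NonIncreasing d′
  d′-noninc i j i<j = by-cases (i ≟ᶠ t) (i ≟ᶠ q)
    where
    d′j≤dj : d′ j ≤ d j
    d′j≤dj = m∸n≤m (d j) (ends j)
    by-cases : Dec (i ≡ t) → Dec (i ≡ q) → d′ j ≤ d′ i
    by-cases (yes refl) _ with <-cmp (toℕ j) (toℕ q)
    ... | tri< j<q _ _ = ≤-trans d′j≤dj (subst (d j ≤_) (cong (d t ∸_) (sym ends-t))
                           (<⇒≤pred (subst (d j <_) (sym dt≡M) (below-M j i<j j<q))))
    ... | tri≈ _ j≡q _ rewrite toℕ-injective j≡q =
                           subst₂ _≤_ (cong (d q ∸_) (sym ends-q)) (cong (d t ∸_) (sym ends-t))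
                             (∸-monoˡ-≤ 1 (d-noninc t q t<q))
    ... | tri> _ _ q<j = ≤-trans d′j≤dj (≤-trans (≤-reflexive (zero-after-q j q<j)) z≤n)
    by-cases (no _) (yes refl) = ≤-trans d′j≤dj (≤-trans (≤-reflexive (zero-after-q j i<j)) z≤n)
    by-cases (no i≢t) (no i≢q) = ≤-trans d′j≤dj (subst (d j ≤_) (sym (d′-elsewhere i≢t i≢q)) (d-noninc i j i<j))

  prefix-d : ∀ k → sum< k d ≡ sum< k d′ + sum< k ends
  prefix-d k = trans (sum<-cong k (λ i _ → d≡d′+ends i)) (sum<-+ k d′ ends)

  prefix-top : ∀ k → k ≤ suc (toℕ t) → sum< k d ≡ k * M
  prefix-top k k≤1+t = trans (sum<-cong k (λ i i<k → d-top i (≤-pred (≤-trans i<k k≤1+t))))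
                             (sum<-const k M (≤-trans k≤1+t (toℕ<n t)))

  prefix-d′-top : ∀ k → k ≤ toℕ t → sum< k d′ ≡ k * M
  prefix-d′-top k k≤t = trans (sum<-cong k unchanged) (sum<-const k M (≤-trans k≤t (<⇒≤ (toℕ<n t))))
    where
    unchanged : ∀ i → toℕ i < k → d′ i ≡ M
    unchanged i i<k = trans (d′-elsewhere (λ i≡t → <-irrefl (cong toℕ i≡t) i<t) (λ i≡q → <-irrefl (cong toℕ i≡q) (<-trans i<t t<q)))
                            (d-top i (<⇒≤ i<t))
      where
      i<t : toℕ i < toℕ t
      i<t = <-≤-trans i<k k≤t

  ⊓-drop : ∀ k i → d i ⊓ k ≤ d′ i ⊓ k + ends i
  ⊓-drop k i = subst (λ x → x ⊓ k ≤ d′ i ⊓ k + ends i) (sym (d≡d′+ends i)) (⊓-+-≤ (d′ i) (ends i) k)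

  ⊓-stable : ∀ {k} i → k < d i → d i ⊓ k ≡ d′ i ⊓ k
  ⊓-stable {k} i k<di = trans (m≥n⇒m⊓n≡n (<⇒≤ k<di)) (sym (m≥n⇒m⊓n≡n k≤d′i))
    where
    k≤d′i : k ≤ d′ i
    k≤d′i = ≤-trans (<⇒≤pred k<di) (∸-monoʳ-≤ (d i) (ends≤1 i))

  tail⊓-drop : ∀ k → tail⊓ k d ≤ tail⊓ k d′ + sum≥ k ends
  tail⊓-drop k = ≤-trans (sum≥-mono-≤ k (λ i _ → ⊓-drop k i)) (≤-reflexive (sum≥-+ k (λ i → d′ i ⊓ k) ends))

  tail⊓-drop-q : ∀ k → k < d t → tail⊓ k d ≤ tail⊓ k d′ + 1
  tail⊓-drop-q k k<dt = begin
    tail⊓ k d                        ≤⟨ sum≥-mono-≤ k (λ i _ → pointwise i (i ≟ᶠ t)) ⟩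
    sum≥ k (λ i → d′ i ⊓ k + δ q i) ≡⟨ sum≥-+ k (λ i → d′ i ⊓ k) (δ q) ⟩
    tail⊓ k d′ + sum≥ k (δ q)       ≤⟨ +-monoʳ-≤ (tail⊓ k d′) (subst (_≤ 1) (sym (sum≥-δ k q)) (𝟙≤1 _)) ⟩
    tail⊓ k d′ + 1                  ∎
    where
    open ≤-Reasoning
    pointwise : ∀ i → Dec (i ≡ t) → d i ⊓ k ≤ d′ i ⊓ k + δ q i
    pointwise i (yes refl) = ≤-trans (≤-reflexive (⊓-stable t k<dt)) (m≤m+n _ _)
    pointwise i (no i≢t)   = subst (λ e → d i ⊓ k ≤ d′ i ⊓ k + e) (ends-off-t i≢t) (⊓-drop k i)

  tail⊓-keep : ∀ k → k < d t → k < d q → tail⊓ k d ≤ tail⊓ k d′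
  tail⊓-keep k k<dt k<dq = sum≥-mono-≤ k (λ i _ → pointwise i (i ≟ᶠ t) (i ≟ᶠ q))
    where
    pointwise : ∀ i → Dec (i ≡ t) → Dec (i ≡ q) → d i ⊓ k ≤ d′ i ⊓ k
    pointwise i (yes refl) _          = ≤-reflexive (⊓-stable t k<dt)
    pointwise i (no _)     (yes refl) = ≤-reflexive (⊓-stable q k<dq)
    pointwise i (no i≢t)   (no i≢q)   = ≤-reflexive (cong (_⊓ k) (sym (d′-elsewhere i≢t i≢q)))

  above : ℕ → ℕ
  above k = sum≥ k (λ i → 𝟙 (k <ᵇ d i))

  tail⊓-suc : ∀ k → k ≤ toℕ t → k < M → tail⊓ (suc k) d + suc k ≡ tail⊓ k d + above k
  tail⊓-suc k k≤t k<M = begin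
    tail⊓ (suc k) d + suc k                        ≡⟨ +-comm _ (suc k) ⟩
    suc k + tail⊓ (suc k) d                        ≡⟨ cong (_+ tail⊓ (suc k) d) dₖ⊓[1+k] ⟨
    d i ⊓ suc k + sum≥ (suc k) (λ j → d j ⊓ suc k) ≡⟨ sum≥-peel k<1+n (λ j → d j ⊓ suc k) ⟨
    sum≥ k (λ j → d j ⊓ suc k)                     ≡⟨ sum≥-cong k (λ j _ → ⊓-suc (d j) k) ⟩
    sum≥ k (λ j → d j ⊓ k + 𝟙 (k <ᵇ d j))          ≡⟨ sum≥-+ k (λ j → d j ⊓ k) (λ j → 𝟙 (k <ᵇ d j)) ⟩
    tail⊓ k d + above k                            ∎
    where
    open ≡-Reasoning
    k<1+n : k < suc n
    k<1+n = ≤-<-trans k≤t (toℕ<n t)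
    i : Fin (suc n)
    i = fromℕ< k<1+n
    dₖ⊓[1+k] : d i ⊓ suc k ≡ suc k
    dₖ⊓[1+k] = trans (cong (_⊓ suc k) (d-top i (subst (_≤ toℕ t) (sym (toℕ-fromℕ< k<1+n)) k≤t))) (m≥n⇒m⊓n≡n k<M)

  above-bound : ∀ k → k ≤ toℕ q → d q ≤ k → k * above k + 1 ≤ tail⊓ k d
  above-bound k k≤q dq≤k = begin
    k * above k + 1                                 ≡⟨ cong₂ _+_ (sum≥-*ˡ k k (λ i → 𝟙 (k <ᵇ d i))) (trans (sum≥-δ k q) (cong (𝟙 ∘ not) (<ᵇ-false k≤q))) ⟨
    sum≥ k (λ i → k * 𝟙 (k <ᵇ d i)) + sum≥ k (δ q) ≡⟨ sum≥-+ k (λ i → k * 𝟙 (k <ᵇ d i)) (δ q) ⟨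
    sum≥ k (λ i → k * 𝟙 (k <ᵇ d i) + δ q i)        ≤⟨ sum≥-mono-≤ k (λ i _ → pointwise i (i ≟ᶠ q)) ⟩
    tail⊓ k d                                       ∎
    where
    open ≤-Reasoning
    pointwise : ∀ i → Dec (i ≡ q) → k * 𝟙 (k <ᵇ d i) + δ q i ≤ d i ⊓ k
    pointwise i (yes refl) = begin
      k * 𝟙 (k <ᵇ d q) + δ q q ≡⟨ cong₂ (λ b e → k * 𝟙 b + e) (<ᵇ-false dq≤k) (δ-refl q) ⟩
      k * 0 + 1                ≡⟨ cong (_+ 1) (*-zeroʳ k) ⟩
      1                        ≤⟨ dq>0 ⟩
      d q                      ≡⟨ m≤n⇒m⊓n≡m dq≤k ⟨
      d q ⊓ k                  ∎
    pointwise i (no i≢q) = begin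
      k * 𝟙 (k <ᵇ d i) + δ q i ≡⟨ cong (k * 𝟙 (k <ᵇ d i) +_) (δ-≢ i≢q) ⟩
      k * 𝟙 (k <ᵇ d i) + 0     ≡⟨ +-identityʳ _ ⟩
      k * 𝟙 (k <ᵇ d i)         ≤⟨ k*𝟙[k<x]≤x⊓k k (d i) ⟩
      d i ⊓ k                  ∎

  ends-tail : ∀ k → k ≤ toℕ t → sum≥ k ends ≡ 2
  ends-tail k k≤t = trans (sum≥-+ k (δ t) (δ q))
    (cong₂ _+_ (trans (sum≥-δ k t) (cong (𝟙 ∘ not) (<ᵇ-false k≤t)))
               (trans (sum≥-δ k q) (cong (𝟙 ∘ not) (<ᵇ-false (≤-trans k≤t (<⇒≤ t<q))))))

  ends-past-t : ∀ k → toℕ t < k → sum≥ k ends ≤ sum< k ends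
  ends-past-t k t<k = begin
    sum≥ k ends                    ≡⟨ sum≥-+ k (δ t) (δ q) ⟩
    sum≥ k (δ t) + sum≥ k (δ q)    ≡⟨ cong₂ _+_ (trans (sum≥-δ k t) (cong (𝟙 ∘ not) (<ᵇ-true t<k))) (sum≥-δ k q) ⟩
    𝟙 (not (toℕ q <ᵇ k))           ≤⟨ 𝟙≤1 _ ⟩
    1                              ≤⟨ m≤m+n 1 _ ⟩
    1 + 𝟙 (toℕ q <ᵇ k)             ≡⟨ cong₂ _+_ (trans (sum<-δ k t) (cong 𝟙 (<ᵇ-true t<k))) (sum<-δ k q) ⟨
    sum< k (δ t) + sum< k (δ q)    ≡⟨ sum<-+ k (δ t) (δ q) ⟨
    sum< k ends                    ∎
    where open ≤-Reasoning

  -- When M = k every entry is at most k, so tail⊓ k d is the whole tail sum, whose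
  -- parity is that of k * k + k; this rules out the value k + 1.
  tail⊓-when-M≡k : ∀ k → k ≤ toℕ t → M ≡ k → k ≤ tail⊓ k d′
  tail⊓-when-M≡k k k≤t M≡k = +-cancelʳ-≤ 2 k _ (begin
    k + 2                   ≡⟨ +-comm k 2 ⟩
    suc (suc k)             ≤⟨ ≤∧≢⇒< tail≥1+k (λ eq → ¬2∣m*m+[1+m] k (subst (2 ∣_) (trans sum-split (cong (k * k +_) (sym eq))) d-even)) ⟩
    tail⊓ k d               ≤⟨ tail⊓-drop k ⟩
    tail⊓ k d′ + sum≥ k ends ≡⟨ cong (tail⊓ k d′ +_) (ends-tail k k≤t) ⟩
    tail⊓ k d′ + 2          ∎)
    where
    open ≤-Reasoning
    tail⊓≡tail : tail⊓ k d ≡ sum≥ k d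
    tail⊓≡tail = sum≥-cong k (λ i _ → m≤n⇒m⊓n≡m (subst (d i ≤_) M≡k (d≤M i)))
    sum-split : sum d ≡ k * k + tail⊓ k d
    sum-split = begin-equality
      sum d                 ≡⟨ sum<+sum≥ k d ⟨
      sum< k d + sum≥ k d   ≡⟨ cong₂ _+_ (trans (prefix-top k (≤-trans k≤t (n≤1+n _))) (cong (k *_) M≡k)) (sym tail⊓≡tail) ⟩
      k * k + tail⊓ k d     ∎
    pointwise : ∀ i → Dec (i ≡ t) → Dec (i ≡ q) → k * δ t i + δ q i ≤ d i
    pointwise i (yes refl) (yes t≡q) = ⊥-elim (t≢q t≡q)
    pointwise i (yes refl) (no i≢q)  = ≤-reflexive (begin-equality
      k * δ t t + δ q t     ≡⟨ cong₂ (λ a b → k * a + b) (δ-refl t) (δ-≢ i≢q) ⟩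
      k * 1 + 0             ≡⟨ trans (+-identityʳ _) (*-identityʳ k) ⟩
      k                     ≡⟨ trans (sym M≡k) (sym dt≡M) ⟩
      d t                   ∎)
    pointwise i (no i≢t)   (yes refl) = begin
      k * δ t q + δ q q     ≡⟨ cong₂ (λ a b → k * a + b) (δ-≢ i≢t) (δ-refl q) ⟩
      k * 0 + 1             ≡⟨ cong (_+ 1) (*-zeroʳ k) ⟩
      1                     ≤⟨ dq>0 ⟩
      d q                   ∎
    pointwise i (no i≢t)   (no i≢q)  = begin
      k * δ t i + δ q i     ≡⟨ cong₂ (λ a b → k * a + b) (δ-≢ i≢t) (δ-≢ i≢q) ⟩
      k * 0 + 0             ≡⟨ trans (+-identityʳ _) (*-zeroʳ k) ⟩
      0                     ≤⟨ z≤n ⟩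
      d i                   ∎
    tail≥1+k : suc k ≤ tail⊓ k d
    tail≥1+k = begin
      suc k                                     ≡⟨ trans (cong (_+ 1) (*-identityʳ k)) (+-comm k 1) ⟨
      k * 1 + 1                                 ≡⟨ cong₂ (λ a b → k * 𝟙 (not a) + 𝟙 (not b)) (<ᵇ-false k≤t) (<ᵇ-false (≤-trans k≤t (<⇒≤ t<q))) ⟨
      k * 𝟙 (not (toℕ t <ᵇ k)) + 𝟙 (not (toℕ q <ᵇ k)) ≡⟨ cong₂ _+_ (cong (k *_) (sum≥-δ k t)) (sum≥-δ k q) ⟨
      k * sum≥ k (δ t) + sum≥ k (δ q)           ≡⟨ cong (_+ sum≥ k (δ q)) (sum≥-*ˡ k k (δ t)) ⟨
      sum≥ k (λ i → k * δ t i) + sum≥ k (δ q)   ≡⟨ sum≥-+ k (λ i → k * δ t i) (δ q) ⟨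
      sum≥ k (λ i → k * δ t i + δ q i)          ≤⟨ sum≥-mono-≤ k (λ i _ → pointwise i (i ≟ᶠ t) (i ≟ᶠ q)) ⟩
      sum≥ k d                                  ≡⟨ tail⊓≡tail ⟨
      tail⊓ k d                                 ∎

  eg-past-t : ∀ k → toℕ t < k → sum< k d′ ≤ k * (k ∸ 1) + tail⊓ k d′
  eg-past-t k t<k = +-cancelʳ-≤ (sum< k ends) _ _ (begin
    sum< k d′ + sum< k ends                          ≡⟨ prefix-d k ⟨
    sum< k d                                         ≤⟨ d-eg k ⟩
    k * (k ∸ 1) + tail⊓ k d                          ≤⟨ +-monoʳ-≤ (k * (k ∸ 1)) (tail⊓-drop k) ⟩
    k * (k ∸ 1) + (tail⊓ k d′ + sum≥ k ends)         ≤⟨ +-monoʳ-≤ (k * (k ∸ 1)) (+-monoʳ-≤ (tail⊓ k d′) (ends-past-t k t<k)) ⟩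
    k * (k ∸ 1) + (tail⊓ k d′ + sum< k ends)         ≡⟨ +-assoc (k * (k ∸ 1)) _ _ ⟨
    k * (k ∸ 1) + tail⊓ k d′ + sum< k ends           ∎)
    where open ≤-Reasoning

  eg-up-to-t : ∀ k → k ≤ toℕ t → sum< k d′ ≤ k * (k ∸ 1) + tail⊓ k d′
  eg-up-to-t k k≤t = subst (_≤ k * (k ∸ 1) + tail⊓ k d′) (sym (prefix-d′-top k k≤t)) (bound (<-cmp M k))
    where
    open ≤-Reasoning
    bound : Tri (M < k) (M ≡ k) (k < M) → k * M ≤ k * (k ∸ 1) + tail⊓ k d′
    bound (tri< M<k _ _) = ≤-trans (*-monoʳ-≤ k (<⇒≤pred M<k)) (m≤m+n _ _)
    bound (tri≈ _ M≡k _) = begin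
      k * M                     ≡⟨ cong (k *_) M≡k ⟩
      k * k                     ≡⟨ m*m≡m*[m∸1]+m k ⟩
      k * (k ∸ 1) + k           ≤⟨ +-monoʳ-≤ (k * (k ∸ 1)) (tail⊓-when-M≡k k k≤t M≡k) ⟩
      k * (k ∸ 1) + tail⊓ k d′  ∎
    bound (tri> _ _ k<M) with k <? d q
    ... | yes k<dq = begin
      k * M                     ≡⟨ prefix-top k (≤-trans k≤t (n≤1+n _)) ⟨
      sum< k d                  ≤⟨ d-eg k ⟩
      k * (k ∸ 1) + tail⊓ k d   ≤⟨ +-monoʳ-≤ (k * (k ∸ 1)) (tail⊓-keep k k<dt k<dq) ⟩
      k * (k ∸ 1) + tail⊓ k d′  ∎
      where
      k<dt : k < d t
      k<dt = subst (k <_) (sym dt≡M) k<M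
    ... | no k≮dq = +-cancelʳ-≤ 1 _ _ (begin
      k * M + 1                       ≤⟨ choudum-arith k M (tail⊓ k d) (above k) step (above-bound k k≤q (≮⇒≥ k≮dq)) ⟩
      k * (k ∸ 1) + tail⊓ k d         ≤⟨ +-monoʳ-≤ (k * (k ∸ 1)) (tail⊓-drop-q k (subst (k <_) (sym dt≡M) k<M)) ⟩
      k * (k ∸ 1) + (tail⊓ k d′ + 1)  ≡⟨ +-assoc (k * (k ∸ 1)) _ 1 ⟨
      k * (k ∸ 1) + tail⊓ k d′ + 1    ∎)
      where
      k≤q : k ≤ toℕ q
      k≤q = ≤-trans k≤t (<⇒≤ t<q)
      step : suc k * M + suc k ≤ suc k * k + (tail⊓ k d + above k)
      step = begin
        suc k * M + suc k                  ≡⟨ cong (_+ suc k) (prefix-top (suc k) (s≤s k≤t)) ⟨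
        sum< (suc k) d + suc k             ≤⟨ +-monoˡ-≤ (suc k) (d-eg (suc k)) ⟩
        suc k * k + tail⊓ (suc k) d + suc k ≡⟨ +-assoc (suc k * k) _ _ ⟩
        suc k * k + (tail⊓ (suc k) d + suc k) ≡⟨ cong (suc k * k +_) (tail⊓-suc k k≤t k<M) ⟩
        suc k * k + (tail⊓ k d + above k)  ∎

  d′-eg : ErdősGallai d′
  d′-eg k with toℕ t <? k
  ... | yes t<k = eg-past-t k t<k
  ... | no t≮k  = eg-up-to-t k (≮⇒≥ t≮k)

degree+δ : ∀ {n} (G : SimpleGraph n) i (a : Fin n) → sum (λ j → 𝟙 (adj G i j) + δ a j) ≡ degree G i + 1
degree+δ G i a = trans (∑-distrib-+ (λ j → 𝟙 (adj G i j)) (δ a)) (cong₂ _+_ (sym (degree-∑ G i)) (∑-δ a))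

module Reinsertion {n} (d d′ : Vector ℕ n) {t q : Fin n} (t≢q : t ≢ q)
  (d≡d′+ends : ∀ i → d i ≡ d′ i + (δ t i + δ q i))
  (dt≤q : d t ≤ toℕ q) (dq-min : ∀ x → toℕ x < toℕ q → d q ≤ d x)
  (G′ : SimpleGraph n) (G′-realizes : Realizes G′ d′) where

  private
    d-t : d t ≡ d′ t + 1
    d-t = trans (d≡d′+ends t) (cong (d′ t +_) (cong₂ _+_ (δ-refl t) (δ-≢ t≢q)))

    d-q : d q ≡ d′ q + 1
    d-q = trans (d≡d′+ends q) (cong (d′ q +_) (cong₂ _+_ (δ-≢ (t≢q ∘ sym)) (δ-refl q)))

    d-elsewhere : ∀ {i} → i ≢ t → i ≢ q → d i ≡ d′ i
    d-elsewhere {i} i≢t i≢q = trans (d≡d′+ends i) (trans (cong (d′ i +_) (cong₂ _+_ (δ-≢ i≢t) (δ-≢ i≢q))) (+-identityʳ _))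

  realize-by-adding : adj G′ t q ≡ false → Graphic d
  realize-by-adding tq∉G′ = setEdge G′ t≢q true , λ i → begin
    degree (setEdge G′ t≢q true) i ≡⟨ degree-addEdge G′ t≢q tq∉G′ i ⟩
    degree G′ i + (δ t i + δ q i)   ≡⟨ cong (_+ (δ t i + δ q i)) (G′-realizes i) ⟩
    d′ i + (δ t i + δ q i)          ≡⟨ d≡d′+ends i ⟨
    d i                             ∎
    where open ≡-Reasoning

  -- t has at most d t - 1 ≤ q - 1 neighbours, so it misses some vertex x ≠ t with x ≤ q;
  -- x ≠ q because t q is an edge.
  non-neighbour : adj G′ t q ≡ true → ∃ λ x → toℕ x < toℕ q × x ≢ t × adj G′ t x ≡ false
  non-neighbour tq∈G′ with any? (λ x → toℕ x <? toℕ q ×-dec (¬? (x ≟ᶠ t) ×-dec (adj G′ t x Boolₚ.≟ false)))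
  ... | yes witness = witness
  ... | no none = ⊥-elim (<-irrefl refl (begin-strict
    toℕ q                                    <⟨ ≤-refl ⟩
    suc (toℕ q)                              ≡⟨ *-identityʳ (suc (toℕ q)) ⟨
    suc (toℕ q) * 1                          ≡⟨ sum<-const {n} (suc (toℕ q)) 1 (toℕ<n q) ⟨
    sum< {n} (suc (toℕ q)) (λ _ → 1)         ≤⟨ sum<-mono-≤ (suc (toℕ q)) (λ j j≤q → covered j (≤-pred j≤q) (j ≟ᶠ t)) ⟩
    sum< (suc (toℕ q)) row                   ≤⟨ sum<≤sum (suc (toℕ q)) row ⟩
    sum row                                  ≡⟨ degree+δ G′ t t ⟩
    degree G′ t + 1                          ≡⟨ cong (_+ 1) (G′-realizes t) ⟩
    d′ t + 1                                 ≡⟨ d-t ⟨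
    d t                                      ≤⟨ dt≤q ⟩
    toℕ q                                    ∎))
    where
    open ≤-Reasoning
    row : Vector ℕ n
    row j = 𝟙 (adj G′ t j) + δ t j
    covered : ∀ j → toℕ j ≤ toℕ q → Dec (j ≡ t) → 1 ≤ row j
    covered j _   (yes refl) = ≤-trans (≤-reflexive (sym (δ-refl t))) (m≤n+m _ _)
    covered j j≤q (no j≢t) with adj G′ t j in tj
    ... | true  = s≤s z≤n
    ... | false with m≤n⇒m<n∨m≡n j≤q
    ...   | inj₁ j<q = ⊥-elim (none (j , j<q , j≢t , tj))
    ...   | inj₂ j≡q = ⊥-elim (true≢false (trans (sym tq∈G′) (trans (cong (adj G′ t) (sym (toℕ-injective j≡q))) tj)))

  -- x is not adjacent to t but has degree at least deg q + 1 while q is adjacent to t,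
  -- so some neighbour y ≠ q of x is not adjacent to q.
  switch-partner : ∀ {x} → toℕ x < toℕ q → x ≢ t → adj G′ t x ≡ false → adj G′ t q ≡ true →
                   ∃ λ y → adj G′ x y ≡ true × adj G′ q y ≡ false × y ≢ q
  switch-partner {x} x<q x≢t tx∉G′ tq∈G′
    with any? (λ y → (adj G′ x y Boolₚ.≟ true) ×-dec ((adj G′ q y Boolₚ.≟ false) ×-dec ¬? (y ≟ᶠ q)))
  ... | yes witness = witness
  ... | no none = ⊥-elim (<-irrefl refl (begin-strict
    d′ q + 1                           ≡⟨ d-q ⟨
    d q                                ≤⟨ dq-min x x<q ⟩
    d x                                ≡⟨ trans (d-elsewhere x≢t x≢q) (sym (G′-realizes x)) ⟩
    degree G′ x                        <⟨ m<m+n _ (s≤s z≤n) ⟩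
    degree G′ x + 1                    ≡⟨ degree+δ G′ x t ⟨
    sum (λ y → 𝟙 (adj G′ x y) + δ t y) ≤⟨ ∑-mono-≤ (λ y → dominated y (y ≟ᶠ t) (y ≟ᶠ q)) ⟩
    sum (λ y → 𝟙 (adj G′ q y) + δ q y) ≡⟨ degree+δ G′ q q ⟩
    degree G′ q + 1                    ≡⟨ cong (_+ 1) (G′-realizes q) ⟩
    d′ q + 1                           ∎))
    where
    open ≤-Reasoning
    x≢q : x ≢ q
    x≢q x≡q = <-irrefl (cong toℕ x≡q) x<q
    dominated : ∀ y → Dec (y ≡ t) → Dec (y ≡ q) → 𝟙 (adj G′ x y) + δ t y ≤ 𝟙 (adj G′ q y) + δ q y
    dominated y (yes refl) _ = ≤-reflexive (trans
      (cong₂ _+_ (cong 𝟙 (trans (SimpleGraph.sym G′ x t) tx∉G′)) (δ-refl t))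
      (sym (cong₂ _+_ (cong 𝟙 (trans (SimpleGraph.sym G′ q t) tq∈G′)) (δ-≢ t≢q))))
    dominated y (no y≢t) (yes refl) = ≤-trans (≤-reflexive (trans (cong (𝟙 (adj G′ x q) +_) (δ-≢ y≢t)) (+-identityʳ _)))
      (≤-trans (𝟙≤1 _) (≤-reflexive (sym (cong₂ _+_ (cong 𝟙 (irr G′ q)) (δ-refl q)))))
    dominated y (no y≢t) (no y≢q) rewrite δ-≢ y≢t | δ-≢ y≢q with adj G′ x y in xy | adj G′ q y in qy
    ... | true  | false = ⊥-elim (none (y , xy , qy , y≢q))
    ... | true  | true  = ≤-refl
    ... | false | _     = z≤n

  realize-by-switching : adj G′ t q ≡ true → Graphic d
  realize-by-switching tq∈G′ with non-neighbour tq∈G′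
  ... | x , x<q , x≢t , tx∉G′ with switch-partner x<q x≢t tx∉G′ tq∈G′
  ...   | y , xy∈G′ , qy∉G′ , y≢q = G₃ , G₃-realizes
    where
    x≢y : x ≢ y
    x≢y refl = true≢false (trans (sym xy∈G′) (irr G′ x))
    t≢y : t ≢ y
    t≢y refl = true≢false (trans (sym xy∈G′) (trans (SimpleGraph.sym G′ x t) tx∉G′))
    t≢x : t ≢ x
    t≢x = x≢t ∘ sym
    q≢x : q ≢ x
    q≢x q≡x = <-irrefl (cong toℕ (sym q≡x)) x<q
    q≢y : q ≢ y
    q≢y = y≢q ∘ sym
    G₁ G₂ G₃ : SimpleGraph n
    G₁ = setEdge G′ x≢y false
    G₂ = setEdge G₁ t≢x true
    G₃ = setEdge G₂ q≢y true
    tx∉G₁ : adj G₁ t x ≡ false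
    tx∉G₁ = trans (adj-setEdge-outside G′ x≢y false t≢x t≢y x) tx∉G′
    qy∉G₂ : adj G₂ q y ≡ false
    qy∉G₂ = trans (adj-setEdge-outside G₁ t≢x true (t≢q ∘ sym) q≢x y)
                  (trans (adj-setEdge-outside G′ x≢y false q≢x q≢y y) qy∉G′)
    G₃-realizes : Realizes G₃ d
    G₃-realizes i = +-cancelʳ-≡ (δ x i + δ y i) _ _ (begin
      degree G₃ i + (δ x i + δ y i)
        ≡⟨ cong (_+ (δ x i + δ y i)) (trans (degree-addEdge G₂ q≢y qy∉G₂ i)
                                            (cong (_+ (δ q i + δ y i)) (degree-addEdge G₁ t≢x tx∉G₁ i))) ⟩
      degree G₁ i + (δ t i + δ x i) + (δ q i + δ y i) + (δ x i + δ y i)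
        ≡⟨ solve 5 (λ g a b c e → g :+ (a :+ b) :+ (c :+ e) :+ (b :+ e) := g :+ (b :+ e) :+ (a :+ c) :+ (b :+ e))
                   refl (degree G₁ i) (δ t i) (δ x i) (δ q i) (δ y i) ⟩
      degree G₁ i + (δ x i + δ y i) + (δ t i + δ q i) + (δ x i + δ y i)
        ≡⟨ cong (λ g → g + (δ t i + δ q i) + (δ x i + δ y i)) (trans (degree-removeEdge G′ x≢y xy∈G′ i) (G′-realizes i)) ⟩
      d′ i + (δ t i + δ q i) + (δ x i + δ y i)
        ≡⟨ cong (_+ (δ x i + δ y i)) (d≡d′+ends i) ⟨
      d i + (δ x i + δ y i) ∎)
      where
      open ≡-Reasoning
      open +-*-Solver

  realization : Graphic d
  realization with adj G′ t q in tq
  ... | true  = realize-by-switching tq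
  ... | false = realize-by-adding tq

emptyGraph : ∀ n → SimpleGraph n
emptyGraph n = record { adj = λ _ _ → false ; sym = λ _ _ → refl ; irr = λ _ → refl }

degree-emptyGraph : ∀ {n} (i : Fin n) → degree (emptyGraph n) i ≡ 0
degree-emptyGraph {n} i = trans (degree-∑ (emptyGraph n) i) (sum-replicate-zero n)

ErdősGallai⇒Graphic : ∀ {n} (d : Vector ℕ n) → 2 ∣ sum d → NonIncreasing d → ErdősGallai d → Graphic d
ErdősGallai⇒Graphic d = by-sum (sum d) d refl
  where
  by-sum : ∀ {n} s (d : Vector ℕ n) → sum d ≡ s → 2 ∣ s → NonIncreasing d → ErdősGallai d → Graphic d
  by-sum zero          d ∑d≡0 _   _       _    = emptyGraph _ , λ i → trans (degree-emptyGraph i) (sym (∑≡0⇒≡0 d ∑d≡0 i))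
  by-sum (suc zero)    d _    2∣1 _       _    = ⊥-elim (>⇒∤ (s≤s (s≤s z≤n)) 2∣1)
  by-sum {zero}  (suc (suc s)) d () _ _ _
  by-sum {suc n} (suc (suc s)) d ∑d≡2+s 2∣2+s d-noninc d-eg =
    Reinsertion.realization d d′ t≢q d≡d′+ends (subst (_≤ toℕ q) (sym dt≡M) M≤q) (λ x → d-noninc x q)
      (proj₁ realized) (proj₂ realized)
    where
    P : Pivots d
    P = pivots d (subst (0 <_) (sym ∑d≡2+s) (s≤s z≤n)) d-noninc d-eg
    open Pivots P
    open ChoudumReduction d d-noninc d-eg (subst (2 ∣_) (sym ∑d≡2+s) 2∣2+s) P
    realized : Graphic d′
    realized = by-sum s d′ (+-cancelʳ-≡ 2 _ _ (trans (sym sum-d) (trans ∑d≡2+s (+-comm 2 s))))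
                 (∣m+n∣m⇒∣n 2∣2+s (n∣n {2})) d′-noninc d′-eg

eg-beyond-length : ∀ {n} (d : Vector ℕ n) {c} → (∀ i → d i ≤ c) → c < n →
                   ∀ k → n ≤ k → sum< k d ≤ k * (k ∸ 1) + tail⊓ k d
eg-beyond-length {n} d {c} d≤c c<n k n≤k = begin
  sum< k d               ≤⟨ sum<≤sum k d ⟩
  sum d                  ≤⟨ ∑-mono-≤ d≤c ⟩
  sum {n} (λ _ → c)      ≡⟨ ∑-const n c ⟩
  n * c                  ≤⟨ *-mono-≤ n≤k (≤-trans (<⇒≤pred c<n) (∸-monoˡ-≤ 1 n≤k)) ⟩
  k * (k ∸ 1)            ≤⟨ m≤m+n _ _ ⟩
  k * (k ∸ 1) + tail⊓ k d ∎
  where open ≤-Reasoning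

k*[n∸1]≡k*[k∸1]+[n∸k]*k : ∀ k n → k ≤ n → k * (n ∸ 1) ≡ k * (k ∸ 1) + (n ∸ k) * k
k*[n∸1]≡k*[k∸1]+[n∸k]*k zero    n       _         = sym (*-zeroʳ n)
k*[n∸1]≡k*[k∸1]+[n∸k]*k (suc k) (suc n) (s≤s k≤n) = begin
  suc k * n                    ≡⟨ cong (suc k *_) (m+[n∸m]≡n k≤n) ⟨
  suc k * (k + (n ∸ k))        ≡⟨ *-distribˡ-+ (suc k) k (n ∸ k) ⟩
  suc k * k + suc k * (n ∸ k)  ≡⟨ cong (suc k * k +_) (*-comm (suc k) (n ∸ k)) ⟩
  suc k * k + (n ∸ k) * suc k  ∎
  where open ≡-Reasoning

BoxCondition : ℕ → ℕ → ℕ → Set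
BoxCondition n c₁ c₂ = ∀ k → k ≤ c₁ → c₂ < k → k * c₁ ≤ k * (k ∸ 1) + (n ∸ k) * c₂

-- Within the box only c₂ < k ≤ c₁ is critical: for larger k the prefix is at most k(k-1),
-- for smaller k every entry of the tail contributes k.
box⇒ErdősGallai : ∀ {n c₁ c₂} → c₁ < n → BoxCondition n c₁ c₂ →
                  ∀ (d : Vector ℕ n) → (∀ i → d i ≤ c₁) → (∀ i → c₂ ≤ d i) → ErdősGallai d
box⇒ErdősGallai {n} {c₁} {c₂} c₁<n box d d≤c₁ c₂≤d k with n ≤? k
... | yes n≤k = eg-beyond-length d d≤c₁ c₁<n k n≤k
... | no n≰k = begin
  sum< k d                            ≤⟨ sum<-mono-≤ k (λ i _ → d≤c₁ i) ⟩
  sum< {n} k (λ _ → c₁)               ≡⟨ sum<-const k c₁ k≤n ⟩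
  k * c₁                              ≤⟨ bound ⟩
  k * (k ∸ 1) + (n ∸ k) * (c₂ ⊓ k)    ≡⟨ cong (k * (k ∸ 1) +_) (sum≥-const k (c₂ ⊓ k) k≤n) ⟨
  k * (k ∸ 1) + sum≥ {n} k (λ _ → c₂ ⊓ k) ≤⟨ +-monoʳ-≤ (k * (k ∸ 1)) (sum≥-mono-≤ k (λ i _ → ⊓-monoˡ-≤ k (c₂≤d i))) ⟩
  k * (k ∸ 1) + tail⊓ k d             ∎
  where
  open ≤-Reasoning
  k≤n : k ≤ n
  k≤n = <⇒≤ (≰⇒> n≰k)
  bound : k * c₁ ≤ k * (k ∸ 1) + (n ∸ k) * (c₂ ⊓ k)
  bound with k ≤? c₂ | c₁ <? k
  ... | yes k≤c₂ | _ = begin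
    k * c₁                             ≤⟨ *-monoʳ-≤ k (<⇒≤pred c₁<n) ⟩
    k * (n ∸ 1)                        ≡⟨ k*[n∸1]≡k*[k∸1]+[n∸k]*k k n k≤n ⟩
    k * (k ∸ 1) + (n ∸ k) * k          ≡⟨ cong (λ z → k * (k ∸ 1) + (n ∸ k) * z) (m≥n⇒m⊓n≡n k≤c₂) ⟨
    k * (k ∸ 1) + (n ∸ k) * (c₂ ⊓ k)   ∎
  ... | no _ | yes c₁<k = ≤-trans (*-monoʳ-≤ k (<⇒≤pred c₁<k)) (m≤m+n _ _)
  ... | no k≰c₂ | no c₁≮k = begin
    k * c₁                             ≤⟨ box k (≮⇒≥ c₁≮k) (≰⇒> k≰c₂) ⟩
    k * (k ∸ 1) + (n ∸ k) * c₂         ≡⟨ cong (λ z → k * (k ∸ 1) + (n ∸ k) * z) (m≤n⇒m⊓n≡m (<⇒≤ (≰⇒> k≰c₂))) ⟨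
    k * (k ∸ 1) + (n ∸ k) * (c₂ ⊓ k)   ∎

-- Equality in an Erdős–Gallai inequality

<ᵇ≡true⇒< : ∀ {m n} → (m <ᵇ n) ≡ true → m < n
<ᵇ≡true⇒< {m} {n} m<ᵇn = <ᵇ⇒< m n (subst T (sym m<ᵇn) tt)

<ᵇ≡false⇒≥ : ∀ {m n} → (m <ᵇ n) ≡ false → n ≤ m
<ᵇ≡false⇒≥ m≮ᵇn = ≮⇒≥ (λ m<n → true≢false (trans (sym (<ᵇ-true m<n)) m≮ᵇn))

𝟙≡0⇒false : ∀ {b} → 𝟙 b ≡ 0 → b ≡ false
𝟙≡0⇒false {false} _ = refl

𝟙≡1⇒true : ∀ {b} → 𝟙 b ≡ 1 → b ≡ true
𝟙≡1⇒true {true} _ = refl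

sum<-sum≥-comm : ∀ {n} k (a : Fin n → Fin n → ℕ) → (∀ i j → a i j ≡ a j i) →
                 sum< k (λ i → sum≥ k (a i)) ≡ sum≥ k (λ i → sum< k (a i))
sum<-sum≥-comm {n} k a a-sym = begin
  sum< k (λ i → sum≥ k (a i))       ≡⟨ sum-cong-≗ by-row ⟩
  sum (λ i → sum (λ j → block i j)) ≡⟨ ∑-comm block ⟩
  sum (λ j → sum (λ i → block i j)) ≡⟨ sum-cong-≗ by-column ⟩
  sum≥ k (λ j → sum< k (a j))       ∎
  where
  open ≡-Reasoning
  block : Fin n → Fin n → ℕ
  block i j = if toℕ i <ᵇ k then restrict≥ k (a i) j else 0
  by-row : ∀ i → restrict< k (λ i → sum≥ k (a i)) i ≡ sum (λ j → block i j)
  by-row i with toℕ i <ᵇ k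
  ... | true  = refl
  ... | false = sym (sum-replicate-zero n)
  by-column : ∀ j → sum (λ i → block i j) ≡ restrict≥ k (λ j → sum< k (a j)) j
  by-column j with toℕ j <ᵇ k
  ... | true  = trans (sum-cong-≗ {n = n} {x = λ i → if toℕ i <ᵇ k then 0 else 0} {y = λ _ → 0} (λ i → Boolₚ.if-eta (toℕ i <ᵇ k))) (sum-replicate-zero n)
  ... | false = sum-cong-≗ (λ i → cong (λ x → if toℕ i <ᵇ k then x else 0) (a-sym i j))

-- Counting edges: the first k degrees sum to 2e(K) + e(K,I) ≤ k(k-1) + e(K,I), the others
-- to e(K,I) + 2e(I); equality forces K complete and e(I) = 0.
module TightErdősGallai {n} (G : SimpleGraph n) {d : Vector ℕ n} (G-realizes : Realizes G d)
  {k} (k≤n : k ≤ n) (tight : sum< k d ≡ k * (k ∸ 1) + sum≥ k d) where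

  private
    a : Fin n → Fin n → ℕ
    a i j = 𝟙 (adj G i j)

    a-sym : ∀ i j → a i j ≡ a j i
    a-sym i j = cong 𝟙 (SimpleGraph.sym G i j)

    inner outer : Vector ℕ n
    inner i = sum< k (a i)
    outer i = sum≥ k (a i)

    d≡inner+outer : ∀ i → d i ≡ inner i + outer i
    d≡inner+outer i = trans (sym (G-realizes i)) (trans (degree-∑ G i) (sym (sum<+sum≥ k (a i))))

    a+δ≤1 : ∀ i j → a i j + δ i j ≤ 1
    a+δ≤1 i j with j ≟ᶠ i
    ... | yes refl = ≤-reflexive (cong (λ b → 𝟙 b + 1) (irr G j))
    ... | no _     = ≤-trans (≤-reflexive (+-identityʳ _)) (𝟙≤1 _)

    inner+1 : ∀ i → toℕ i < k → sum< k (λ j → a i j + δ i j) ≡ inner i + 1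
    inner+1 i i<k = trans (sum<-+ k (a i) (δ i)) (cong (inner i +_) (trans (sum<-δ k i) (cong 𝟙 (<ᵇ-true i<k))))

    inner≤k∸1 : ∀ i → toℕ i < k → inner i ≤ k ∸ 1
    inner≤k∸1 i i<k = ≤-trans (≤-reflexive (sym (m+n∸n≡m (inner i) 1))) (∸-monoˡ-≤ 1 (begin
      inner i + 1                       ≡⟨ inner+1 i i<k ⟨
      sum< k (λ j → a i j + δ i j)      ≤⟨ sum<-mono-≤ k (λ j _ → a+δ≤1 i j) ⟩
      sum< {n} k (λ _ → 1)              ≡⟨ trans (sum<-const k 1 k≤n) (*-identityʳ k) ⟩
      k                                 ∎))
      where open ≤-Reasoning

    inner-total≤ : sum< k inner ≤ k * (k ∸ 1)
    inner-total≤ = ≤-trans (sum<-mono-≤ k inner≤k∸1) (≤-reflexive (sum<-const k (k ∸ 1) k≤n))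

    inner-total≡ : sum< k inner ≡ k * (k ∸ 1) + sum≥ k outer
    inner-total≡ = +-cancelʳ-≡ (sum< k outer) _ _ (begin
      sum< k inner + sum< k outer                          ≡⟨ sum<-+ k inner outer ⟨
      sum< k (λ i → inner i + outer i)                     ≡⟨ sum<-cong k (λ i _ → d≡inner+outer i) ⟨
      sum< k d                                             ≡⟨ tight ⟩
      k * (k ∸ 1) + sum≥ k d                               ≡⟨ cong (k * (k ∸ 1) +_) (sum≥-cong k (λ i _ → d≡inner+outer i)) ⟩
      k * (k ∸ 1) + sum≥ k (λ i → inner i + outer i)       ≡⟨ cong (k * (k ∸ 1) +_) (sum≥-+ k inner outer) ⟩
      k * (k ∸ 1) + (sum≥ k inner + sum≥ k outer)          ≡⟨ cong (λ x → k * (k ∸ 1) + (x + sum≥ k outer)) (sum<-sum≥-comm k a a-sym) ⟨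
      k * (k ∸ 1) + (sum< k outer + sum≥ k outer)          ≡⟨ solve 3 (λ x y z → x :+ (y :+ z) := x :+ z :+ y) refl (k * (k ∸ 1)) _ _ ⟩
      k * (k ∸ 1) + sum≥ k outer + sum< k outer            ∎)
      where
      open ≡-Reasoning
      open +-*-Solver

    outer-total≡0 : sum≥ k outer ≡ 0
    outer-total≡0 = n≤0⇒n≡0 (+-cancelˡ-≤ (k * (k ∸ 1)) _ 0
      (≤-trans (≤-reflexive (sym inner-total≡)) (≤-trans inner-total≤ (≤-reflexive (sym (+-identityʳ _))))))

    inner≡k∸1 : ∀ i → toℕ i < k → inner i ≡ k ∸ 1
    inner≡k∸1 = sum<-rigid k inner≤k∸1 (begin
      sum< {n} k (λ _ → k ∸ 1) ≡⟨ sum<-const k (k ∸ 1) k≤n ⟩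
      k * (k ∸ 1)              ≤⟨ m≤m+n _ _ ⟩
      k * (k ∸ 1) + sum≥ k outer ≡⟨ inner-total≡ ⟨
      sum< k inner             ∎)
      where open ≤-Reasoning

    clique : ∀ i j → i ≢ j → toℕ i < k → toℕ j < k → adj G i j ≡ true
    clique i j i≢j i<k j<k = 𝟙≡1⇒true (trans (sym (+-identityʳ _)) (trans (cong (a i j +_) (sym (δ-≢ (i≢j ∘ sym))))
      (sum<-rigid k (λ j _ → a+δ≤1 i j) (begin
        sum< {n} k (λ _ → 1)          ≡⟨ trans (sum<-const k 1 k≤n) (*-identityʳ k) ⟩
        k                             ≡⟨ m∸n+n≡m (≤-trans (s≤s z≤n) (≤-trans (s≤s (z≤n {toℕ i})) i<k)) ⟨
        k ∸ 1 + 1                     ≡⟨ cong (_+ 1) (inner≡k∸1 i i<k) ⟨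
        inner i + 1                   ≡⟨ inner+1 i i<k ⟨
        sum< k (λ j → a i j + δ i j)  ∎) j j<k)))
      where open ≤-Reasoning

    independent : ∀ i j → k ≤ toℕ i → k ≤ toℕ j → adj G i j ≡ false
    independent i j k≤i k≤j = 𝟙≡0⇒false (sum≥≡0⇒≡0 k (a i) (sum≥≡0⇒≡0 k outer outer-total≡0 i k≤i) j k≤j)

  tight⇒split : IsSplit G
  tight⇒split = (λ i → toℕ i <ᵇ k)
    , (λ i j i≢j i∈K j∈K → clique i j i≢j (<ᵇ≡true⇒< i∈K) (<ᵇ≡true⇒< j∈K))
    , (λ i j i∉K j∉K → independent i j (<ᵇ≡false⇒≥ i∉K) (<ᵇ≡false⇒≥ j∉K))

-- A split degree sequence in the box

split-sequence-arith : ∀ k₀ j R c → c ≤ k₀ →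
  suc k₀ * k₀ + (j + R) * c + j * c ≤ (suc k₀ + j) * (k₀ + j) + R * c
split-sequence-arith k₀ j R c c≤k₀ = begin
  suc k₀ * k₀ + (j + R) * c + j * c                    ≡⟨ solve 4 (λ k₀ j R c → (con 1 :+ k₀) :* k₀ :+ (j :+ R) :* c :+ j :* c
                                                              := (con 1 :+ k₀) :* k₀ :+ (j :* c :+ j :* c) :+ R :* c) refl k₀ j R c ⟩
  suc k₀ * k₀ + (j * c + j * c) + R * c                ≤⟨ +-monoˡ-≤ (R * c) (+-monoʳ-≤ (suc k₀ * k₀) (+-mono-≤ (*-monoʳ-≤ j c≤k₀) (*-monoʳ-≤ j c≤k₀))) ⟩
  suc k₀ * k₀ + (j * k₀ + j * k₀) + R * c              ≤⟨ +-monoˡ-≤ (R * c) (m≤m+n _ (j * suc j)) ⟩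
  suc k₀ * k₀ + (j * k₀ + j * k₀) + j * suc j + R * c  ≡⟨ solve 4 (λ k₀ j R c → (con 1 :+ k₀) :* k₀ :+ (j :* k₀ :+ j :* k₀) :+ j :* (con 1 :+ j) :+ R :* c
                                                              := (con 1 :+ k₀ :+ j) :* (k₀ :+ j) :+ R :* c) refl k₀ j R c ⟩
  (suc k₀ + j) * (k₀ + j) + R * c                      ∎
  where
  open ≤-Reasoning
  open +-*-Solver

-- The degree sequence of a clique on k = k₀ + 1 vertices joined to n - k independent vertices
-- of degree c₂, whose x = (n - k) c₂ edges to the clique are spread as evenly as possible.
module SplitWitness {n c₁ c₂ k₀ : ℕ} (c₂≤k₀ : c₂ ≤ k₀) (k₀<c₁ : k₀ < c₁) (c₁<n : c₁ < n)
  (violated : suc k₀ * k₀ + (n ∸ suc k₀) * c₂ < suc k₀ * c₁) where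

  k m x q r : ℕ
  k = suc k₀
  m = n ∸ k
  x = m * c₂
  q = x / k
  r = x % k

  s : Vector ℕ n
  s i = if toℕ i <ᵇ k then k₀ + (q + 𝟙 (toℕ i <ᵇ r)) else c₂

  private
    k≤n : k ≤ n
    k≤n = ≤-trans k₀<c₁ (<⇒≤ c₁<n)

    r<k : r < k
    r<k = m%n<n x k

    x≡kq+r : x ≡ k * q + r
    x≡kq+r = trans (m≡m%n+[m/n]*n x k) (trans (+-comm r (q * k)) (cong (_+ r) (*-comm q k)))

    q<m : q < m
    q<m = *-cancelˡ-< k q m (begin-strict
      k * q      ≤⟨ m≤m+n (k * q) r ⟩
      k * q + r  ≡⟨ x≡kq+r ⟨
      m * c₂     <⟨ *-monoʳ-< m (s≤s c₂≤k₀) ⟩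
      m * k      ≡⟨ *-comm m k ⟩
      k * m      ∎)
      where
      open ≤-Reasoning
      instance
        m-nonZero : NonZero m
        m-nonZero = >-nonZero (m<n⇒0<n∸m (≤-trans (s≤s k₀<c₁) c₁<n))

    k₀+q<c₁ : k₀ + q < c₁
    k₀+q<c₁ = *-cancelˡ-< k (k₀ + q) c₁ (begin-strict
      k * (k₀ + q)    ≡⟨ *-distribˡ-+ k k₀ q ⟩
      k * k₀ + k * q  ≤⟨ +-monoʳ-≤ (k * k₀) (≤-trans (m≤m+n (k * q) r) (≤-reflexive (sym x≡kq+r))) ⟩
      k * k₀ + x      <⟨ violated ⟩
      k * c₁          ∎)
      where open ≤-Reasoning

    s-clique : ∀ i → toℕ i < k → s i ≡ k₀ + (q + 𝟙 (toℕ i <ᵇ r))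
    s-clique i i<k = cong (λ b → if b then k₀ + (q + 𝟙 (toℕ i <ᵇ r)) else c₂) (<ᵇ-true i<k)

    s-independent : ∀ i → k ≤ toℕ i → s i ≡ c₂
    s-independent i k≤i = cong (λ b → if b then k₀ + (q + 𝟙 (toℕ i <ᵇ r)) else c₂) (<ᵇ-false k≤i)

  s≤c₁ : ∀ i → s i ≤ c₁
  s≤c₁ i with toℕ i <ᵇ k
  ... | true  = ≤-trans (+-monoʳ-≤ k₀ (+-monoʳ-≤ q (𝟙≤1 _)))
                  (subst (_≤ c₁) (sym (trans (cong (k₀ +_) (+-comm q 1)) (+-suc k₀ q))) k₀+q<c₁)
  ... | false = ≤-trans c₂≤k₀ (<⇒≤ k₀<c₁)

  c₂≤s : ∀ i → c₂ ≤ s i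
  c₂≤s i with toℕ i <ᵇ k
  ... | true  = ≤-trans c₂≤k₀ (m≤m+n k₀ _)
  ... | false = ≤-refl

  s-noninc : NonIncreasing s
  s-noninc i j i<j with toℕ i <ᵇ k | <ᵇ-reflects-< (toℕ i) k | toℕ j <ᵇ k | <ᵇ-reflects-< (toℕ j) k
  ... | true  | _        | true  | _       = +-monoʳ-≤ k₀ (+-monoʳ-≤ q (later≤earlier (toℕ j <ᵇ r) (<ᵇ-reflects-< (toℕ j) r)))
    where
    later≤earlier : ∀ b → Reflects (toℕ j < r) b → 𝟙 b ≤ 𝟙 (toℕ i <ᵇ r)
    later≤earlier true  (ofʸ j<r) = ≤-reflexive (cong 𝟙 (sym (<ᵇ-true (<-trans i<j j<r))))
    later≤earlier false _         = z≤n
  ... | true  | _        | false | _       = ≤-trans c₂≤k₀ (m≤m+n k₀ _)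
  ... | false | ofⁿ i≮k  | true  | ofʸ j<k = ⊥-elim (i≮k (<-trans i<j j<k))
  ... | false | _        | false | _       = ≤-refl

  s-prefix : ∀ k′ → k′ ≤ k → sum< k′ s ≡ k′ * k₀ + (k′ * q + k′ ⊓ r)
  s-prefix k′ k′≤k = begin
    sum< k′ s                                            ≡⟨ sum<-cong k′ (λ i i<k′ → s-clique i (<-≤-trans i<k′ k′≤k)) ⟩
    sum< k′ clique-degree            ≡⟨ sum<-+ k′ (replicate n k₀) (λ i → q + 𝟙 (toℕ i <ᵇ r)) ⟩
    sum< k′ (replicate n k₀) + sum< k′ (λ i → q + surplus i) ≡⟨ cong (sum< k′ (replicate n k₀) +_) (sum<-+ k′ (replicate n q) surplus) ⟩
    sum< k′ (replicate n k₀) + (sum< k′ (replicate n q) + sum< k′ surplus)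
      ≡⟨ cong₂ _+_ (sum<-const k′ k₀ k′≤n) (cong₂ _+_ (sum<-const k′ q k′≤n) (sum<-count k′ r k′≤n)) ⟩
    k′ * k₀ + (k′ * q + k′ ⊓ r)                          ∎
    where
    open ≡-Reasoning
    surplus clique-degree : Vector ℕ n
    surplus i = 𝟙 (toℕ i <ᵇ r)
    clique-degree i = k₀ + (q + surplus i)
    k′≤n : k′ ≤ n
    k′≤n = ≤-trans k′≤k k≤n

  s-clique-sum : sum< k s ≡ k * k₀ + x
  s-clique-sum = trans (s-prefix k ≤-refl) (cong (k * k₀ +_) (trans (cong (k * q +_) (m≥n⇒m⊓n≡n (<⇒≤ r<k))) (sym x≡kq+r)))

  s-tail : ∀ k′ → k ≤ k′ → k′ ≤ n → sum≥ k′ s ≡ (n ∸ k′) * c₂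
  s-tail k′ k≤k′ k′≤n = trans (sum≥-cong k′ (λ i k′≤i → s-independent i (≤-trans k≤k′ k′≤i))) (sum≥-const k′ c₂ k′≤n)

  s-tight : sum< k s ≡ k * (k ∸ 1) + sum≥ k s
  s-tight = trans s-clique-sum (cong (k * k₀ +_) (sym (s-tail k ≤-refl k≤n)))

  s-even : 2 ∣ sum s
  s-even = subst (2 ∣_) sum≡ (∣m∣n⇒∣m+n (subst (2 ∣_) (*-comm k₀ k) (2∣n*[1+n] k₀)) (m∣m*n x))
    where
    open +-*-Solver
    sum≡ : k * k₀ + 2 * x ≡ sum s
    sum≡ = begin
      k * k₀ + 2 * x        ≡⟨ solve 2 (λ a x → a :+ con 2 :* x := a :+ x :+ x) refl (k * k₀) x ⟩
      k * k₀ + x + x        ≡⟨ cong₂ _+_ s-clique-sum (s-tail k ≤-refl k≤n) ⟨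
      sum< k s + sum≥ k s   ≡⟨ sum<+sum≥ k s ⟩
      sum s                 ∎
      where open ≡-Reasoning

  eg-within-clique : ∀ k′ → k′ ≤ k → sum< k′ s ≤ k′ * (k′ ∸ 1) + tail⊓ k′ s
  eg-within-clique k′ k′≤k = begin
    sum< k′ s                                              ≡⟨ s-prefix k′ k′≤k ⟩
    k′ * k₀ + (k′ * q + k′ ⊓ r)                            ≤⟨ +-monoʳ-≤ (k′ * k₀) spread ⟩
    k′ * k₀ + m * (c₂ ⊓ k′)                                ≡⟨ cong (_+ m * (c₂ ⊓ k′)) (k*[n∸1]≡k*[k∸1]+[n∸k]*k k′ k k′≤k) ⟩
    k′ * (k′ ∸ 1) + (k ∸ k′) * k′ + m * (c₂ ⊓ k′)          ≡⟨ +-assoc (k′ * (k′ ∸ 1)) _ _ ⟩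
    k′ * (k′ ∸ 1) + ((k ∸ k′) * k′ + m * (c₂ ⊓ k′))        ≤⟨ +-monoʳ-≤ (k′ * (k′ ∸ 1)) tail-bound ⟩
    k′ * (k′ ∸ 1) + tail⊓ k′ s                             ∎
    where
    open ≤-Reasoning
    spread : k′ * q + k′ ⊓ r ≤ m * (c₂ ⊓ k′)
    spread with c₂ ≤? k′
    ... | yes c₂≤k′ = begin
      k′ * q + k′ ⊓ r   ≤⟨ +-mono-≤ (*-monoˡ-≤ q k′≤k) (m⊓n≤n k′ r) ⟩
      k * q + r         ≡⟨ x≡kq+r ⟨
      m * c₂            ≡⟨ cong (m *_) (m≤n⇒m⊓n≡m c₂≤k′) ⟨
      m * (c₂ ⊓ k′)     ∎
    ... | no c₂≰k′ = begin
      k′ * q + k′ ⊓ r   ≤⟨ +-monoʳ-≤ (k′ * q) (m⊓n≤m k′ r) ⟩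
      k′ * q + k′       ≡⟨ trans (+-comm (k′ * q) k′) (sym (*-suc k′ q)) ⟩
      k′ * suc q        ≤⟨ *-monoʳ-≤ k′ q<m ⟩
      k′ * m            ≡⟨ *-comm k′ m ⟩
      m * k′            ≡⟨ cong (m *_) (m≥n⇒m⊓n≡n (<⇒≤ (≰⇒> c₂≰k′))) ⟨
      m * (c₂ ⊓ k′)     ∎
    lower : ∀ i → k′ ≤ toℕ i → restrict< k (replicate n k′) i + restrict≥ k (replicate n (c₂ ⊓ k′)) i ≤ s i ⊓ k′
    lower i k′≤i with toℕ i <ᵇ k | <ᵇ-reflects-< (toℕ i) k
    ... | true  | ofʸ i<k = ≤-reflexive (trans (+-identityʳ k′) (sym (m≥n⇒m⊓n≡n
                              (≤-trans (≤-pred (≤-trans (s≤s k′≤i) i<k)) (m≤m+n k₀ _)))))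
    ... | false | _       = ≤-refl
    tail-bound : (k ∸ k′) * k′ + m * (c₂ ⊓ k′) ≤ tail⊓ k′ s
    tail-bound = begin
      (k ∸ k′) * k′ + m * (c₂ ⊓ k′)
        ≡⟨ cong₂ _+_ (sum≥-band k′ k′≤k k≤n) (trans (sum≥-restrict≥ k′≤k (replicate n (c₂ ⊓ k′))) (sum≥-const k (c₂ ⊓ k′) k≤n)) ⟨
      sum≥ k′ (restrict< k (replicate n k′)) + sum≥ k′ (restrict≥ k (replicate n (c₂ ⊓ k′)))
        ≡⟨ sum≥-+ k′ (restrict< k (replicate n k′)) (restrict≥ k (replicate n (c₂ ⊓ k′))) ⟨
      sum≥ k′ (λ i → restrict< k (replicate n k′) i + restrict≥ k (replicate n (c₂ ⊓ k′)) i)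
        ≤⟨ sum≥-mono-≤ k′ lower ⟩
      tail⊓ k′ s ∎

  eg-past-clique : ∀ j → k + j ≤ n → sum< (k + j) s ≤ (k + j) * (k + j ∸ 1) + tail⊓ (k + j) s
  eg-past-clique j k+j≤n = begin
    sum< (k + j) s                          ≡⟨ sum<-extend (m≤m+n k j) s ⟩
    sum< k s + sum≥ k (restrict< (k + j) s) ≡⟨ cong₂ _+_ s-clique-sum band ⟩
    k * k₀ + x + j * c₂                     ≡⟨ cong (λ z → k * k₀ + z * c₂ + j * c₂) m≡j+R ⟩
    k * k₀ + (j + R) * c₂ + j * c₂          ≤⟨ split-sequence-arith k₀ j R c₂ c₂≤k₀ ⟩
    (k + j) * (k₀ + j) + R * c₂             ≡⟨ cong ((k + j) * (k₀ + j) +_) tail ⟨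
    (k + j) * (k + j ∸ 1) + tail⊓ (k + j) s ∎
    where
    open ≤-Reasoning
    R : ℕ
    R = n ∸ (k + j)
    m≡j+R : m ≡ j + R
    m≡j+R = trans (cong (_∸ k) (sym (m+[n∸m]≡n k+j≤n))) (trans (cong (_∸ k) (+-assoc k j R)) (m+n∸m≡n k (j + R)))
    band : sum≥ k (restrict< (k + j) s) ≡ j * c₂
    band = begin-equality
      sum≥ k (restrict< (k + j) s)             ≡⟨ sum≥-cong k (λ i k≤i → cong (λ v → if toℕ i <ᵇ k + j then v else 0) (s-independent i k≤i)) ⟩
      sum≥ k (restrict< (k + j) (replicate n c₂))    ≡⟨ sum≥-band c₂ (m≤m+n k j) k+j≤n ⟩
      (k + j ∸ k) * c₂                         ≡⟨ cong (_* c₂) (m+n∸m≡n k j) ⟩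
      j * c₂                                   ∎
    tail : tail⊓ (k + j) s ≡ R * c₂
    tail = trans (sum≥-cong (k + j) (λ i k+j≤i → trans (cong (_⊓ (k + j)) (s-independent i (≤-trans (m≤m+n k j) k+j≤i)))
                                                      (m≤n⇒m⊓n≡m (≤-trans c₂≤k₀ (≤-trans (n≤1+n k₀) (m≤m+n k j))))))
                 (sum≥-const (k + j) c₂ k+j≤n)

  s-eg : ErdősGallai s
  s-eg k′ with k′ ≤? k | k′ ≤? n
  ... | yes k′≤k | _       = eg-within-clique k′ k′≤k
  ... | no k′≰k  | yes k′≤n = subst (λ l → sum< l s ≤ l * (l ∸ 1) + tail⊓ l s) (m+[n∸m]≡n k≤k′)
                                (eg-past-clique (k′ ∸ k) (subst (_≤ n) (sym (m+[n∸m]≡n k≤k′)) k′≤n))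
    where
    k≤k′ : k ≤ k′
    k≤k′ = <⇒≤ (≰⇒> k′≰k)
  ... | no _     | no k′≰n  = eg-beyond-length s s≤c₁ c₁<n k′ (<⇒≤ (≰⇒> k′≰n))

  s-in-box : InD n c₁ c₂ s
  s-in-box = s≤c₁ , c₂≤s , s-noninc , n∣m⇒m%n≡0 (sum s) 2 s-even

  s-split : SplitDegSeq s
  s-split = ErdősGallai⇒Graphic s s-even s-noninc s-eg
          , λ G G-realizes → TightErdősGallai.tight⇒split G G-realizes k≤n s-tight

Violation : ℕ → ℕ → ℕ → ℕ → Set
Violation n c₁ c₂ k = c₂ < k × k ≤ c₁ × k * (k ∸ 1) + (n ∸ k) * c₂ < k * c₁

box-or-violation : ∀ n c₁ c₂ → BoxCondition n c₁ c₂ ⊎ ∃ (Violation n c₁ c₂)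
box-or-violation n c₁ c₂ = decide (any? (λ (k : Fin (suc c₁)) → violates? (toℕ k)))
  where
  violates : ℕ → Set
  violates k = c₂ < k × k * (k ∸ 1) + (n ∸ k) * c₂ < k * c₁
  violates? : ∀ k → Dec (violates k)
  violates? k = c₂ <? k ×-dec k * (k ∸ 1) + (n ∸ k) * c₂ <? k * c₁
  decide : Dec (∃ λ (k : Fin (suc c₁)) → violates (toℕ k)) → BoxCondition n c₁ c₂ ⊎ ∃ (Violation n c₁ c₂)
  decide (yes (k , c₂<k , violated)) = inj₂ (toℕ k , c₂<k , ≤-pred (toℕ<n k) , violated)
  decide (no none) = inj₁ λ k k≤c₁ c₂<k → ≮⇒≥ λ violated →
    none (fromℕ< (s≤s k≤c₁) , subst violates (sym (toℕ-fromℕ< (s≤s k≤c₁))) (c₂<k , violated))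

theorem5p3 : (n c₁ c₂ : ℕ) → c₂ ≤ c₁ → c₁ < n →
    ¬ FullyGraphic n c₁ c₂ →
    Σ (Vector ℕ n) λ d → InD n c₁ c₂ d × SplitDegSeq d
theorem5p3 n c₁ c₂ _ c₁<n ¬fully-graphic with box-or-violation n c₁ c₂
... | inj₁ box = ⊥-elim (¬fully-graphic λ d (d≤c₁ , c₂≤d , d-noninc , even) →
  ErdősGallai⇒Graphic d (m%n≡0⇒n∣m (sum d) 2 even) d-noninc (box⇒ErdősGallai c₁<n box d d≤c₁ c₂≤d))
... | inj₂ (suc k₀ , c₂<k , k≤c₁ , violated) = s , s-in-box , s-split
  where open SplitWitness (≤-pred c₂<k) k≤c₁ c₁<n violated
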